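{- Let $\ell$ be a positive integer coprime to $3$, let $q=2^m$ with $m$ a positive integer, let $\omega\in\mathbb{F}_4\setminus\mathbb{F}_2$, and let $h,e\in\mathbb{F}_q\setminus\mathbb{F}_2$ satisfy $h^3=e^2+e+1$. Put $b:=1/\sqrt{e}\in\mathbb{F}_q$, $c:=(b+\omega)/(b+\omega^2)$, and $G_\ell(X):=X^{2q^\ell+1}+hX+e$. Then $G_\ell(X)$ has either zero or three roots in $\mu_{q^2+q+1}$. It has three such roots if and only if $(e+\omega)^{(q^2-1)/3}=\omega^{ -\ell}$, in which case these roots are the three roots of $X^3+h^2X^2+(e+1)hX+1$; explicitly, they are the values $h^2+e\sqrt{h}(v+v^{ -1})$ as $v$ ranges over the cube roots of $\omega c$.
   Context: $\mu_{q^2+q+1}$ denotes the set of $(q^2+q+1)$-th roots of unity in $\mathbb{F}_{q^3}^*$. Square roots are taken in $\mathbb{F}_q$ (where squaring is bijective). All fields are viewed inside a fixed algebraic closure of $\mathbb{F}_2$, where the cube roots $v$ are taken. -}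

module Defs where

open import Level using (Level; _⊔_; suc)
open import Data.Nat as ℕ using (ℕ; zero; _≥_)
import Data.Nat.Base
open import Data.List using (List; []; _∷_; _∷ʳ_)
open import Data.Product using (Σ; ∃; ∃-syntax; _×_; _,_)
open import Data.Sum using (_⊎_)
open import Relation.Nullary using (¬_)
open import Relation.Binary using (Decidable)
open import Algebra.Bundles using (CommutativeRing)

module _ {c ℓ} (R : CommutativeRing c ℓ) where
  open CommutativeRing R

  pow : Carrier → ℕ → Carrier
  pow x zero = 1#
  pow x (ℕ.suc n) = x * pow x n

  evalPoly : List Carrier → Carrier → Carrier
  evalPoly [] x = 0#
  evalPoly (a ∷ as) x = a + x * evalPoly as x

-- An algebraic closure of 𝔽₂: a field of characteristic 2 with decidable
-- equality, which is algebraically closed and algebraic over 𝔽₂ (every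
-- element lies in some finite field 𝔽_{2^n}, i.e. satisfies x^(2^n) = x
-- for some n ≥ 1).
record AlgClosureF2 c ℓ : Set (suc (c ⊔ ℓ)) where
  field
    cring : CommutativeRing c ℓ
  open CommutativeRing cring
  field
    _≟_        : Decidable _≈_
    0≉1        : ¬ (0# ≈ 1#)
    inverse    : ∀ x → ¬ (x ≈ 0#) → ∃[ y ] (x * y ≈ 1#)
    char2      : 1# + 1# ≈ 0#
    -- every polynomial of degree ≥ 1 whose leading coefficient is 1 has a root
    algClosed  : ∀ (as : List Carrier) → ∀ x₀ → 
                 ∃[ x ] (evalPoly cring (x₀ ∷ (as ∷ʳ 1#)) x ≈ 0#)
    algebraic  : ∀ x → ∃[ n ] (pow cring x (2 Data.Nat.Base.^ ℕ.suc n) ≈ x)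

{-# OPTIONS --safe #-}
module Submission where

-- Cardano: with u³ = e + ω and u u′ = h (take u = √h v for a cube root v of ω c), the roots of
-- X³ + h² X² + (e + 1) h X + 1 are x_σ = h² + e (σ u + σ² u′) for σ³ = 1, and x₁ x_ω x_ω² = 1.
-- The Frobenius x ↦ x^q permutes them as x_σ ↦ x_{σρ} for a cube root of unity ρ with
-- ρ² = (e + ω)^((q² - 1)/3); so x_σ ∈ μ_{q²+q+1} once ρ ≠ 1, and G(x_σ) = x_σ x_{σρˡ}² + h x_σ + e.
-- As x_σ x_{σω}² + h x_σ + e = 0 and the x_σ are distinct, x_σ is a root of G iff ρˡ = ω, which
-- (since l² ≡ 1 mod 3) is the condition (e + ω)^((q² - 1)/3) ω^l = 1. Conversely, a root x of G
-- in μ_{q²+q+1} satisfies x x^q x^{q²} = 1 and x^{q³} = x, and then G(x) = 0 together with a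
-- Frobenius conjugate of it gives (x + h²) · (x³ + h² x² + (e + 1) h x + 1) = 0, where x = h² is
-- impossible because h ∈ 𝔽_q forces h⁶ = 1 and hence e ∈ 𝔽₂.

open import Defs
open import Level using (0ℓ; _⊔_)
import Level
open import Data.Nat as ℕ using (ℕ; zero; suc; _≥_; _∸_; _%_; _/_; s≤s)
import Data.Nat.Properties as ℕ
open import Data.Nat.DivMod using (m≡m%n+[m/n]*n; m%n<n; %-distribˡ-*; m*n/n≡m)
open import Data.Nat.Divisibility using (∣-refl; m%n≡0⇒n∣m)
open import Data.Nat.Coprimality using (Coprime)
open import Data.List using (_∷_; [])
open import Data.Maybe.Base using (Maybe; just; nothing)
open import Data.Product using (∃; ∃-syntax; _×_; _,_; proj₁; proj₂)
open import Data.Sum using (_⊎_; inj₁; inj₂; [_,_]′)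
import Data.Sum
open import Relation.Nullary using (¬_; Dec; yes; no; contradiction)
open import Relation.Nullary.Decidable using (decidable-stable)
open import Relation.Binary.PropositionalEquality as ≡ using (_≡_)
open import Function.Base using (_∘_)
open import Function.Bundles using (_⇔_; mk⇔; module Equivalence)
open import Algebra.Bundles using (CommutativeRing)
open import Algebra.Bundles.Raw using (RawRing)
open import Algebra.Solver.Ring.AlmostCommutativeRing
  using (fromCommutativeRing; _-Raw-AlmostCommutative⟶_)
import Algebra.Properties.CommutativeSemiring.Exp as Exp
import Algebra.Properties.Group as GroupProperties
import Algebra.Solver.Ring
import Algebra.Solver.Ring.NaturalCoefficients.Default as ℕ-Solver

Unit₃ : ℕ → Set
Unit₃ n = n % 3 ≡ 1 ⊎ n % 3 ≡ 2

2^m-unit₃ : ∀ m → Unit₃ (2 ℕ.^ m)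
2^m-unit₃ zero    = inj₁ ≡.refl
2^m-unit₃ (suc m) with 2^m-unit₃ m
... | inj₁ r≡1 = inj₂ (≡.trans (%-distribˡ-* 2 (2 ℕ.^ m) 3) (≡.cong (λ r → (2 ℕ.* r) % 3) r≡1))
... | inj₂ r≡2 = inj₁ (≡.trans (%-distribˡ-* 2 (2 ℕ.^ m) 3) (≡.cong (λ r → (2 ℕ.* r) % 3) r≡2))

coprime⇒unit₃ : ∀ {l} → Coprime l 3 → Unit₃ l
coprime⇒unit₃ {l} l⊥3 with l % 3 in l%3≡r | m%n<n l 3
... | 0 | _ = contradiction (l⊥3 (m%n≡0⇒n∣m l 3 l%3≡r , ∣-refl)) λ ()
... | 1 | _ = inj₁ ≡.refl
... | 2 | _ = inj₂ ≡.refl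
... | suc (suc (suc _)) | s≤s (s≤s (s≤s ()))

unit₃-square : ∀ n → Unit₃ n → (n ℕ.* n) % 3 ≡ 1
unit₃-square n n-unit = ≡.trans (%-distribˡ-* n n 3) (square n-unit)
  where
  square : Unit₃ n → ((n % 3) ℕ.* (n % 3)) % 3 ≡ 1
  square (inj₁ r≡1) rewrite r≡1 = ≡.refl
  square (inj₂ r≡2) rewrite r≡2 = ≡.refl

n%3≡1⇒n≡3*[n∸1]/3+1 : ∀ n → n % 3 ≡ 1 → n ≡ 3 ℕ.* ((n ∸ 1) / 3) ℕ.+ 1
n%3≡1⇒n≡3*[n∸1]/3+1 n n%3≡1 = begin
  n                           ≡⟨ n≡1+k*3 ⟩
  1 ℕ.+ k ℕ.* 3               ≡⟨ ℕ.+-comm 1 (k ℕ.* 3) ⟩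
  k ℕ.* 3 ℕ.+ 1               ≡⟨ ≡.cong (λ j → j ℕ.* 3 ℕ.+ 1) [n∸1]/3≡k ⟨
  (n ∸ 1) / 3 ℕ.* 3 ℕ.+ 1     ≡⟨ ≡.cong (ℕ._+ 1) (ℕ.*-comm ((n ∸ 1) / 3) 3) ⟩
  3 ℕ.* ((n ∸ 1) / 3) ℕ.+ 1   ∎
  where
  open ≡.≡-Reasoning
  k = n / 3
  n≡1+k*3 : n ≡ 1 ℕ.+ k ℕ.* 3
  n≡1+k*3 = ≡.trans (m≡m%n+[m/n]*n n 3) (≡.cong (ℕ._+ k ℕ.* 3) n%3≡1)
  [n∸1]/3≡k : (n ∸ 1) / 3 ≡ k
  [n∸1]/3≡k = ≡.trans (≡.cong (λ j → (j ∸ 1) / 3) n≡1+k*3) (m*n/n≡m k 3)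

data 𝔽₄ : Set where
  0ᶠ 1ᶠ ωᶠ ω²ᶠ : 𝔽₄

infixl 6 _+ᶠ_
infixl 7 _*ᶠ_

_+ᶠ_ : 𝔽₄ → 𝔽₄ → 𝔽₄
0ᶠ  +ᶠ y   = y
x   +ᶠ 0ᶠ  = x
1ᶠ  +ᶠ 1ᶠ  = 0ᶠ
1ᶠ  +ᶠ ωᶠ  = ω²ᶠ
1ᶠ  +ᶠ ω²ᶠ = ωᶠ
ωᶠ  +ᶠ 1ᶠ  = ω²ᶠ
ωᶠ  +ᶠ ωᶠ  = 0ᶠ
ωᶠ  +ᶠ ω²ᶠ = 1ᶠ
ω²ᶠ +ᶠ 1ᶠ  = ωᶠ
ω²ᶠ +ᶠ ωᶠ  = 1ᶠ
ω²ᶠ +ᶠ ω²ᶠ = 0ᶠ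

_*ᶠ_ : 𝔽₄ → 𝔽₄ → 𝔽₄
0ᶠ  *ᶠ y   = 0ᶠ
1ᶠ  *ᶠ y   = y
x   *ᶠ 0ᶠ  = 0ᶠ
x   *ᶠ 1ᶠ  = x
ωᶠ  *ᶠ ωᶠ  = ω²ᶠ
ωᶠ  *ᶠ ω²ᶠ = 1ᶠ
ω²ᶠ *ᶠ ωᶠ  = 1ᶠ
ω²ᶠ *ᶠ ω²ᶠ = ωᶠ

𝔽₄-rawRing : RawRing 0ℓ 0ℓ
𝔽₄-rawRing = record
  { Carrier = 𝔽₄ ; _≈_ = _≡_ ; _+_ = _+ᶠ_ ; _*_ = _*ᶠ_ ; -_ = λ x → x ; 0# = 0ᶠ ; 1# = 1ᶠ }

module CharacteristicTwo {c ℓ} (R : CommutativeRing c ℓ) where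

  open CommutativeRing R
  open import Relation.Binary.Reasoning.Setoid setoid

  module Properties (1+1≈0 : 1# + 1# ≈ 0#) where

    [1+1]x≈0 : ∀ x → (1# + 1#) * x ≈ 0#
    [1+1]x≈0 x = trans (*-congʳ 1+1≈0) (zeroˡ x)

    x+x≈0 : ∀ x → x + x ≈ 0#
    x+x≈0 x = begin
      x + x            ≈⟨ +-cong (*-identityˡ x) (*-identityˡ x) ⟨
      1# * x + 1# * x  ≈⟨ distribʳ x 1# 1# ⟨
      (1# + 1#) * x    ≈⟨ [1+1]x≈0 x ⟩
      0#               ∎

    x+y≈z⇒x≈z+y : ∀ {x y z} → x + y ≈ z → x ≈ z + y
    x+y≈z⇒x≈z+y {x} {y} {z} x+y≈z = begin
      x            ≈⟨ +-identityʳ x ⟨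
      x + 0#       ≈⟨ +-congˡ (x+x≈0 y) ⟨
      x + (y + y)  ≈⟨ +-assoc x y y ⟨
      x + y + y    ≈⟨ +-congʳ x+y≈z ⟩
      z + y        ∎

    x+y≈0⇒x≈y : ∀ {x y} → x + y ≈ 0# → x ≈ y
    x+y≈0⇒x≈y {y = y} x+y≈0 = trans (x+y≈z⇒x≈z+y x+y≈0) (+-identityˡ y)

    x≈y⇒x+y≈0 : ∀ {x y} → x ≈ y → x + y ≈ 0#
    x≈y⇒x+y≈0 {y = y} x≈y = trans (+-congʳ x≈y) (x+x≈0 y)

    x+y+z≈0⇒x≈y+z : ∀ {x y z} → x + y + z ≈ 0# → x ≈ y + z
    x+y+z≈0⇒x≈y+z {x} {y} {z} x+y+z≈0 = x+y≈0⇒x≈y (trans (sym (+-assoc x y z)) x+y+z≈0)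

    x≈-x : ∀ x → x ≈ - x
    x≈-x x = x+y≈0⇒x≈y (-‿inverseʳ x)

    modulo : ∀ {x y r s t} → r ≈ s → x ≈ y + (r + s) * t → x ≈ y
    modulo {x} {y} {r} {s} {t} r≈s x≈y+[r+s]t = begin
      x                ≈⟨ x≈y+[r+s]t ⟩
      y + (r + s) * t  ≈⟨ +-congˡ (*-congʳ (x≈y⇒x+y≈0 r≈s)) ⟩
      y + 0# * t       ≈⟨ +-congˡ (zeroˡ t) ⟩
      y + 0#           ≈⟨ +-identityʳ y ⟩
      y                ∎

  -- A ring of characteristic 2 containing a root ω of X² + X + 1 is an 𝔽₄-algebra, so
  -- identities in it can be normalised with 𝔽₄ coefficients and ω as a constant.
  module 𝔽₄-Solver (1+1≈0 : 1# + 1# ≈ 0#) (ω : Carrier) (ω²+ω+1≈0 : pow R ω 2 + ω + 1# ≈ 0#) where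

    open Properties 1+1≈0

    private
      ω² = pow R ω 2

      ω²+ω≈1 : ω² + ω ≈ 1#
      ω²+ω≈1 = trans (x+y≈z⇒x≈z+y ω²+ω+1≈0) (+-identityˡ 1#)

      ω+ω²≈1 : ω + ω² ≈ 1#
      ω+ω²≈1 = trans (+-comm ω ω²) ω²+ω≈1

      ω²≈1+ω : ω² ≈ 1# + ω
      ω²≈1+ω = x+y≈z⇒x≈z+y ω²+ω≈1

      ω≈1+ω² : ω ≈ 1# + ω²
      ω≈1+ω² = x+y≈z⇒x≈z+y ω+ω²≈1

      ω*ω≈ω² : ω * ω ≈ ω²
      ω*ω≈ω² = *-congˡ (sym (*-identityʳ ω))

      ω*ω²≈1 : ω * ω² ≈ 1#
      ω*ω²≈1 = begin
        ω * ω²          ≈⟨ *-congˡ ω²≈1+ω ⟩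
        ω * (1# + ω)    ≈⟨ distribˡ ω 1# ω ⟩
        ω * 1# + ω * ω  ≈⟨ +-cong (*-identityʳ ω) ω*ω≈ω² ⟩
        ω + ω²          ≈⟨ ω+ω²≈1 ⟩
        1#              ∎

      ω²*ω²≈ω : ω² * ω² ≈ ω
      ω²*ω²≈ω = begin
        ω² * ω²           ≈⟨ *-congʳ ω²≈1+ω ⟩
        (1# + ω) * ω²     ≈⟨ distribʳ ω² 1# ω ⟩
        1# * ω² + ω * ω²  ≈⟨ +-cong (*-identityˡ ω²) ω*ω²≈1 ⟩
        ω² + 1#           ≈⟨ +-comm ω² 1# ⟩
        1# + ω²           ≈⟨ ω≈1+ω² ⟨
        ω                 ∎

      ⟦_⟧ᶠ : 𝔽₄ → Carrier
      ⟦ 0ᶠ ⟧ᶠ  = 0#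
      ⟦ 1ᶠ ⟧ᶠ  = 1#
      ⟦ ωᶠ ⟧ᶠ  = ω
      ⟦ ω²ᶠ ⟧ᶠ = ω²

      +-homo : ∀ x y → ⟦ x +ᶠ y ⟧ᶠ ≈ ⟦ x ⟧ᶠ + ⟦ y ⟧ᶠ
      +-homo 0ᶠ  y   = sym (+-identityˡ _)
      +-homo 1ᶠ  0ᶠ  = sym (+-identityʳ _)
      +-homo ωᶠ  0ᶠ  = sym (+-identityʳ _)
      +-homo ω²ᶠ 0ᶠ  = sym (+-identityʳ _)
      +-homo 1ᶠ  1ᶠ  = sym (x+x≈0 1#)
      +-homo ωᶠ  ωᶠ  = sym (x+x≈0 ω)
      +-homo ω²ᶠ ω²ᶠ = sym (x+x≈0 ω²)
      +-homo 1ᶠ  ωᶠ  = ω²≈1+ω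
      +-homo ωᶠ  1ᶠ  = trans ω²≈1+ω (+-comm 1# ω)
      +-homo 1ᶠ  ω²ᶠ = ω≈1+ω²
      +-homo ω²ᶠ 1ᶠ  = trans ω≈1+ω² (+-comm 1# ω²)
      +-homo ωᶠ  ω²ᶠ = sym ω+ω²≈1
      +-homo ω²ᶠ ωᶠ  = sym ω²+ω≈1

      *-homo : ∀ x y → ⟦ x *ᶠ y ⟧ᶠ ≈ ⟦ x ⟧ᶠ * ⟦ y ⟧ᶠ
      *-homo 0ᶠ  y   = sym (zeroˡ _)
      *-homo 1ᶠ  y   = sym (*-identityˡ _)
      *-homo ωᶠ  0ᶠ  = sym (zeroʳ _)
      *-homo ω²ᶠ 0ᶠ  = sym (zeroʳ _)
      *-homo ωᶠ  1ᶠ  = sym (*-identityʳ _)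
      *-homo ω²ᶠ 1ᶠ  = sym (*-identityʳ _)
      *-homo ωᶠ  ωᶠ  = sym ω*ω≈ω²
      *-homo ωᶠ  ω²ᶠ = sym ω*ω²≈1
      *-homo ω²ᶠ ωᶠ  = sym (trans (*-comm ω² ω) ω*ω²≈1)
      *-homo ω²ᶠ ω²ᶠ = sym ω²*ω²≈ω

      homomorphism : 𝔽₄-rawRing -Raw-AlmostCommutative⟶ fromCommutativeRing R
      homomorphism = record
        { ⟦_⟧ = ⟦_⟧ᶠ ; +-homo = +-homo ; *-homo = *-homo ; -‿homo = λ x → x≈-x ⟦ x ⟧ᶠ
        ; 0-homo = refl ; 1-homo = refl }

      same : ∀ x y → Maybe (⟦ x ⟧ᶠ ≈ ⟦ y ⟧ᶠ)
      same 0ᶠ  0ᶠ  = just refl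
      same 1ᶠ  1ᶠ  = just refl
      same ωᶠ  ωᶠ  = just refl
      same ω²ᶠ ω²ᶠ = just refl
      same _   _   = nothing

    open Algebra.Solver.Ring 𝔽₄-rawRing (fromCommutativeRing R) homomorphism same public
      using (Polynomial; con; _:+_; _:*_; _:^_; _:=_; solve)

    :0 :1 :ω :ω² : ∀ {n} → Polynomial n
    :0  = con 0ᶠ
    :1  = con 1ᶠ
    :ω  = con ωᶠ
    :ω² = con ω²ᶠ

module FieldTheory {a r} (K : AlgClosureF2 a r) where

  open AlgClosureF2 K
  open CommutativeRing cring
  open CharacteristicTwo.Properties cring char2 public
  open GroupProperties +-group public using () renaming (∙-cancelˡ to +-cancelˡ)
  open import Relation.Binary.Reasoning.Setoid setoid

  infixr 8 _^_
  _^_ : Carrier → ℕ → Carrier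
  _^_ = pow cring

  private
    module E = Exp commutativeSemiring

    pow≡^ : ∀ x n → x ^ n ≡ x E.^ n
    pow≡^ x zero    = ≡.refl
    pow≡^ x (suc n) = ≡.cong (x *_) (pow≡^ x n)

  ^-congˡ : ∀ n {x y} → x ≈ y → x ^ n ≈ y ^ n
  ^-congˡ n {x} {y} x≈y rewrite pow≡^ x n | pow≡^ y n = E.^-congˡ n x≈y

  ^-congʳ : ∀ x {m n} → m ≡ n → x ^ m ≈ x ^ n
  ^-congʳ x m≡n = reflexive (≡.cong (x ^_) m≡n)

  ^-homo-* : ∀ x m n → x ^ (m ℕ.+ n) ≈ x ^ m * x ^ n
  ^-homo-* x m n rewrite pow≡^ x (m ℕ.+ n) | pow≡^ x m | pow≡^ x n = E.^-homo-* x m n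

  ^-assocʳ : ∀ x m n → (x ^ m) ^ n ≈ x ^ (m ℕ.* n)
  ^-assocʳ x m n rewrite pow≡^ (x ^ m) n | pow≡^ x m | pow≡^ x (m ℕ.* n) = E.^-assocʳ x m n

  ^-distrib-* : ∀ x y n → (x * y) ^ n ≈ x ^ n * y ^ n
  ^-distrib-* x y n rewrite pow≡^ (x * y) n | pow≡^ x n | pow≡^ y n = E.^-distrib-* x y n

  ^-comm : ∀ x m n → (x ^ m) ^ n ≈ (x ^ n) ^ m
  ^-comm x m n = begin
    (x ^ m) ^ n   ≈⟨ ^-assocʳ x m n ⟩
    x ^ (m ℕ.* n) ≈⟨ ^-congʳ x (ℕ.*-comm m n) ⟩
    x ^ (n ℕ.* m) ≈⟨ ^-assocʳ x n m ⟨
    (x ^ n) ^ m   ∎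

  1^n≈1 : ∀ n → 1# ^ n ≈ 1#
  1^n≈1 zero    = refl
  1^n≈1 (suc n) = trans (*-identityˡ _) (1^n≈1 n)

  0^n≈0 : ∀ n .{{_ : ℕ.NonZero n}} → 0# ^ n ≈ 0#
  0^n≈0 (suc n) = zeroˡ _

  *-integral : ∀ {x y} → x * y ≈ 0# → x ≈ 0# ⊎ y ≈ 0#
  *-integral {x} {y} xy≈0 with x ≟ 0#
  ... | yes x≈0 = inj₁ x≈0
  ... | no x≉0 with inverse x x≉0
  ...   | x⁻¹ , xx⁻¹≈1 = inj₂ (begin
    y              ≈⟨ *-identityˡ y ⟨
    1# * y         ≈⟨ *-congʳ xx⁻¹≈1 ⟨
    x * x⁻¹ * y    ≈⟨ *-congʳ (*-comm x x⁻¹) ⟩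
    x⁻¹ * x * y    ≈⟨ *-assoc x⁻¹ x y ⟩
    x⁻¹ * (x * y)  ≈⟨ *-congˡ xy≈0 ⟩
    x⁻¹ * 0#       ≈⟨ zeroʳ x⁻¹ ⟩
    0#             ∎)

  *-integral₃ : ∀ {x y z} → x * y * z ≈ 0# → x ≈ 0# ⊎ y ≈ 0# ⊎ z ≈ 0#
  *-integral₃ xyz≈0 = [ (λ xy≈0 → [ inj₁ , (λ y≈0 → inj₂ (inj₁ y≈0)) ]′ (*-integral xy≈0))
                      , (λ z≈0 → inj₂ (inj₂ z≈0)) ]′ (*-integral xyz≈0)

  *≈1⇒nonzero : ∀ {x y} → x * y ≈ 1# → ¬ x ≈ 0#
  *≈1⇒nonzero {x} {y} xy≈1 x≈0 = 0≉1 (begin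
    0#      ≈⟨ zeroˡ y ⟨
    0# * y  ≈⟨ *-congʳ x≈0 ⟨
    x * y   ≈⟨ xy≈1 ⟩
    1#      ∎)

  *-cancelˡ : ∀ {x y z} → ¬ x ≈ 0# → x * y ≈ x * z → y ≈ z
  *-cancelˡ {x} {y} {z} x≉0 xy≈xz =
    [ (λ x≈0 → contradiction x≈0 x≉0) , x+y≈0⇒x≈y ]′ (*-integral (trans (distribˡ x y z) (x≈y⇒x+y≈0 xy≈xz)))

  ^≈0⇒≈0 : ∀ n {x} → x ^ suc n ≈ 0# → x ≈ 0#
  ^≈0⇒≈0 zero    x¹≈0 = [ (λ x≈0 → x≈0) , (λ 1≈0 → contradiction (sym 1≈0) 0≉1) ]′ (*-integral x¹≈0)
  ^≈0⇒≈0 (suc n) xⁿ≈0 = [ (λ x≈0 → x≈0) , ^≈0⇒≈0 n ]′ (*-integral xⁿ≈0)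

  x²+x≈0-roots : ∀ {x} → x ^ 2 + x ≈ 0# → x ≈ 0# ⊎ x ≈ 1#
  x²+x≈0-roots {x} x²+x≈0 = [ inj₁ , (λ x+1≈0 → inj₂ (x+y≈0⇒x≈y x+1≈0)) ]′ (*-integral (begin
    x * (x + 1#)          ≈⟨ distribˡ x x 1# ⟩
    x * x + x * 1#        ≈⟨ +-cong (*-congˡ (sym (*-identityʳ x))) (*-identityʳ x) ⟩
    x * (x * 1#) + x      ≈⟨ x²+x≈0 ⟩
    0#                    ∎))

  μ₃-* : ∀ {σ τ} → σ ^ 3 ≈ 1# → τ ^ 3 ≈ 1# → (σ * τ) ^ 3 ≈ 1#
  μ₃-* {σ} {τ} σ³≈1 τ³≈1 = begin
    (σ * τ) ^ 3      ≈⟨ ^-distrib-* σ τ 3 ⟩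
    σ ^ 3 * τ ^ 3    ≈⟨ *-cong σ³≈1 τ³≈1 ⟩
    1# * 1#          ≈⟨ *-identityˡ 1# ⟩
    1#               ∎

  μ₃-^ : ∀ {σ} → σ ^ 3 ≈ 1# → ∀ n → (σ ^ n) ^ 3 ≈ 1#
  μ₃-^ {σ} σ³≈1 n = begin
    (σ ^ n) ^ 3  ≈⟨ ^-comm σ n 3 ⟩
    (σ ^ 3) ^ n  ≈⟨ ^-congˡ n σ³≈1 ⟩
    1# ^ n       ≈⟨ 1^n≈1 n ⟩
    1#           ∎

  μ₃-^-% : ∀ {σ} → σ ^ 3 ≈ 1# → ∀ n → σ ^ n ≈ σ ^ (n % 3)
  μ₃-^-% {σ} σ³≈1 n = begin
    σ ^ n                            ≈⟨ ^-congʳ σ (m≡m%n+[m/n]*n n 3) ⟩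
    σ ^ (n % 3 ℕ.+ n / 3 ℕ.* 3)      ≈⟨ ^-homo-* σ (n % 3) (n / 3 ℕ.* 3) ⟩
    σ ^ (n % 3) * σ ^ (n / 3 ℕ.* 3)  ≈⟨ *-congˡ (^-assocʳ σ (n / 3) 3) ⟨
    σ ^ (n % 3) * (σ ^ (n / 3)) ^ 3  ≈⟨ *-congˡ (μ₃-^ σ³≈1 (n / 3)) ⟩
    σ ^ (n % 3) * 1#                 ≈⟨ *-identityʳ _ ⟩
    σ ^ (n % 3)                      ∎

  μ₃-^-square : ∀ {σ} n → Unit₃ n → σ ^ 3 ≈ 1# → σ ^ (n ℕ.* n) ≈ σ
  μ₃-^-square {σ} n n-unit σ³≈1 = begin
    σ ^ (n ℕ.* n)        ≈⟨ μ₃-^-% σ³≈1 (n ℕ.* n) ⟩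
    σ ^ ((n ℕ.* n) % 3)  ≈⟨ ^-congʳ σ (unit₃-square n n-unit) ⟩
    σ * 1#               ≈⟨ *-identityʳ σ ⟩
    σ                    ∎

  ^-2n+1 : ∀ x n → x ^ (2 ℕ.* n ℕ.+ 1) ≈ x * (x ^ n) ^ 2
  ^-2n+1 x n = begin
    x ^ (2 ℕ.* n ℕ.+ 1)    ≈⟨ ^-homo-* x (2 ℕ.* n) 1 ⟩
    x ^ (2 ℕ.* n) * x ^ 1  ≈⟨ *-cong (trans (^-congʳ x (ℕ.*-comm 2 n)) (sym (^-assocʳ x n 2))) (*-identityʳ x) ⟩
    (x ^ n) ^ 2 * x        ≈⟨ *-comm _ x ⟩
    x * (x ^ n) ^ 2        ∎

  ^2-distrib-+ : ∀ x y → (x + y) ^ 2 ≈ x ^ 2 + y ^ 2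
  ^2-distrib-+ x y = begin
    (x + y) ^ 2                          ≈⟨ solve 2 (λ x y → (x :+ y) :^ 2 := x :^ 2 :+ y :^ 2 :+ con 2 :* (x :* y)) refl x y ⟩
    x ^ 2 + y ^ 2 + (1# + 1#) * (x * y)  ≈⟨ +-congˡ ([1+1]x≈0 (x * y)) ⟩
    x ^ 2 + y ^ 2 + 0#                   ≈⟨ +-identityʳ _ ⟩
    x ^ 2 + y ^ 2                        ∎
    where open ℕ-Solver commutativeSemiring

  ^2-injective : ∀ {x y} → x ^ 2 ≈ y ^ 2 → x ≈ y
  ^2-injective {x} {y} x²≈y² = x+y≈0⇒x≈y (^≈0⇒≈0 1 (trans (^2-distrib-+ x y) (x≈y⇒x+y≈0 x²≈y²)))

  frobenius-+ : ∀ k x y → (x + y) ^ (2 ℕ.^ k) ≈ x ^ (2 ℕ.^ k) + y ^ (2 ℕ.^ k)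
  frobenius-+ zero    x y = distribʳ 1# x y
  frobenius-+ (suc k) x y = begin
    (x + y) ^ (2 ℕ.* 2 ℕ.^ k)                   ≈⟨ ^-assocʳ (x + y) 2 (2 ℕ.^ k) ⟨
    ((x + y) ^ 2) ^ (2 ℕ.^ k)                   ≈⟨ ^-congˡ (2 ℕ.^ k) (^2-distrib-+ x y) ⟩
    (x ^ 2 + y ^ 2) ^ (2 ℕ.^ k)                 ≈⟨ frobenius-+ k (x ^ 2) (y ^ 2) ⟩
    (x ^ 2) ^ (2 ℕ.^ k) + (y ^ 2) ^ (2 ℕ.^ k)   ≈⟨ +-cong (^-assocʳ x 2 (2 ℕ.^ k)) (^-assocʳ y 2 (2 ℕ.^ k)) ⟩
    x ^ (2 ℕ.* 2 ℕ.^ k) + y ^ (2 ℕ.* 2 ℕ.^ k)   ∎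

  cube-root : ∀ x → ∃[ v ] v ^ 3 ≈ x
  cube-root x with algClosed (0# ∷ 0# ∷ []) x
  ... | v , root = v , x+y≈0⇒x≈y (trans
    (solve 2 (λ v x → v :^ 3 :+ x := x :+ v :* (con 0 :+ v :* (con 0 :+ v :* (con 1 :+ v :* con 0)))) refl v x) root)
    where open ℕ-Solver commutativeSemiring

  primitive-cube-root : ∀ {ω} → ω ^ 4 ≈ ω → ¬ ω ≈ 0# → ¬ ω ≈ 1# → ω ^ 2 + ω + 1# ≈ 0#
  primitive-cube-root {ω} ω⁴≈ω ω≉0 ω≉1 =
    [ (λ ω+1≈0 → contradiction (x+y≈0⇒x≈y ω+1≈0) ω≉1) , (λ ω²+ω+1≈0 → ω²+ω+1≈0) ]′ (*-integral (begin
      (ω + 1#) * (ω ^ 2 + ω + 1#)           ≈⟨ solve 1 (λ x → (x :+ con 1) :* (x :^ 2 :+ x :+ con 1)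
                                                          := x :^ 3 :+ con 1 :+ con 2 :* (x :^ 2 :+ x)) refl ω ⟩
      ω ^ 3 + 1# + (1# + 1#) * (ω ^ 2 + ω)  ≈⟨ +-cong (x≈y⇒x+y≈0 ω³≈1) ([1+1]x≈0 _) ⟩
      0# + 0#                               ≈⟨ +-identityʳ 0# ⟩
      0#                                    ∎))
    where
    open ℕ-Solver commutativeSemiring
    ω³≈1 : ω ^ 3 ≈ 1#
    ω³≈1 = *-cancelˡ ω≉0 (trans ω⁴≈ω (sym (*-identityʳ ω)))

  module PrimitiveCubeRoot (ω : Carrier) (ω²+ω+1≈0 : ω ^ 2 + ω + 1# ≈ 0#) where

    open CharacteristicTwo.𝔽₄-Solver cring char2 ω ω²+ω+1≈0 public

    ω³≈1 : ω ^ 3 ≈ 1#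
    ω³≈1 = solve 0 (:ω :^ 3 := :1) refl

    ω≉1 : ¬ ω ≈ 1#
    ω≉1 ω≈1 = 0≉1 (begin
      0#                  ≈⟨ ω²+ω+1≈0 ⟨
      ω ^ 2 + ω + 1#      ≈⟨ +-congʳ (+-cong (^-congˡ 2 ω≈1) ω≈1) ⟩
      1# ^ 2 + 1# + 1#    ≈⟨ solve 0 (:1 :^ 2 :+ :1 :+ :1 := :1) refl ⟩
      1#                  ∎)

    ω≉ω² : ¬ ω ≈ ω ^ 2
    ω≉ω² ω≈ω² = 0≉1 (begin
      0#          ≈⟨ x≈y⇒x+y≈0 ω≈ω² ⟨
      ω + ω ^ 2   ≈⟨ solve 0 (:ω :+ :ω² := :1) refl ⟩
      1#          ∎)

    ω²≉1 : ¬ ω ^ 2 ≈ 1#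
    ω²≉1 ω²≈1 = ω≉1 (begin
      ω           ≈⟨ *-identityʳ ω ⟨
      ω * 1#      ≈⟨ *-congˡ ω²≈1 ⟨
      ω * ω ^ 2   ≈⟨ solve 0 (:ω :* :ω² := :1) refl ⟩
      1#          ∎)

    μ₃-classification : ∀ {σ} → σ ^ 3 ≈ 1# → σ ≈ 1# ⊎ σ ≈ ω ⊎ σ ≈ ω ^ 2
    μ₃-classification {σ} σ³≈1 = Data.Sum.map x+y≈0⇒x≈y (Data.Sum.map x+y≈0⇒x≈y x+y≈0⇒x≈y)
      (*-integral₃ (trans (solve 1 (λ σ → (σ :+ :1) :* (σ :+ :ω) :* (σ :+ :ω²) := σ :^ 3 :+ :1) refl σ)
                          (x≈y⇒x+y≈0 σ³≈1)))

    -- With l² ≡ 1 (mod 3), raising to the l-th power is an involution of μ₃.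
    μ₃-twist : ∀ {ρ l} → ρ ^ 3 ≈ 1# → Unit₃ l → ρ ^ 2 * ω ^ l ≈ 1# ⇔ ρ ^ l ≈ ω
    μ₃-twist {ρ} {l} ρ³≈1 l-unit = mk⇔ to from
      where
      to : ρ ^ 2 * ω ^ l ≈ 1# → ρ ^ l ≈ ω
      to ρ²ωˡ≈1 = begin
        ρ ^ l              ≈⟨ ^-congˡ l ωˡ≈ρ ⟨
        (ω ^ l) ^ l        ≈⟨ ^-assocʳ ω l l ⟩
        ω ^ (l ℕ.* l)      ≈⟨ μ₃-^-square l l-unit ω³≈1 ⟩
        ω                  ∎
        where
        ωˡ≈ρ : ω ^ l ≈ ρ
        ωˡ≈ρ = begin
          ω ^ l                  ≈⟨ *-identityˡ _ ⟨
          1# * ω ^ l             ≈⟨ *-congʳ ρ³≈1 ⟨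
          ρ ^ 3 * ω ^ l          ≈⟨ solve 2 (λ ρ x → ρ :^ 3 :* x := ρ :* (ρ :^ 2 :* x)) refl ρ (ω ^ l) ⟩
          ρ * (ρ ^ 2 * ω ^ l)    ≈⟨ *-congˡ ρ²ωˡ≈1 ⟩
          ρ * 1#                 ≈⟨ *-identityʳ ρ ⟩
          ρ                      ∎
      from : ρ ^ l ≈ ω → ρ ^ 2 * ω ^ l ≈ 1#
      from ρˡ≈ω = begin
        ρ ^ 2 * ω ^ l          ≈⟨ *-congˡ (^-congˡ l ρˡ≈ω) ⟨
        ρ ^ 2 * (ρ ^ l) ^ l    ≈⟨ *-congˡ (trans (^-assocʳ ρ l l) (μ₃-^-square l l-unit ρ³≈1)) ⟩
        ρ ^ 2 * ρ              ≈⟨ solve 1 (λ ρ → ρ :^ 2 :* ρ := ρ :^ 3) refl ρ ⟩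
        ρ ^ 3                  ≈⟨ ρ³≈1 ⟩
        1#                     ∎

    μ₃-+-cube : ∀ {σ τ} → σ ^ 3 ≈ 1# → τ ^ 3 ≈ 1# → ¬ σ ≈ τ → (σ + τ) ^ 3 ≈ 1#
    μ₃-+-cube {σ} {τ} σ³≈1 τ³≈1 σ≉τ = begin
      (σ + τ) ^ 3                       ≈⟨ solve 2 (λ σ τ → (σ :+ τ) :^ 3 := σ :^ 3 :+ τ :* (σ :^ 2 :+ σ :* τ :+ τ :^ 2)) refl σ τ ⟩
      σ ^ 3 + τ * (σ ^ 2 + σ * τ + τ ^ 2) ≈⟨ +-cong σ³≈1 (trans (*-congˡ σ²+στ+τ²≈0) (zeroʳ τ)) ⟩
      1# + 0#                           ≈⟨ +-identityʳ 1# ⟩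
      1#                                ∎
      where
      σ²+στ+τ²≈0 : σ ^ 2 + σ * τ + τ ^ 2 ≈ 0#
      σ²+στ+τ²≈0 = [ (λ σ+τ≈0 → contradiction (x+y≈0⇒x≈y σ+τ≈0) σ≉τ) , (λ q≈0 → q≈0) ]′ (*-integral (begin
        (σ + τ) * (σ ^ 2 + σ * τ + τ ^ 2)  ≈⟨ solve 2 (λ σ τ → (σ :+ τ) :* (σ :^ 2 :+ σ :* τ :+ τ :^ 2) := σ :^ 3 :+ τ :^ 3) refl σ τ ⟩
        σ ^ 3 + τ ^ 3                      ≈⟨ +-cong σ³≈1 τ³≈1 ⟩
        1# + 1#                            ≈⟨ char2 ⟩
        0#                                 ∎))

  module CardanoPairs (ω : Carrier) (ω²+ω+1≈0 : ω ^ 2 + ω + 1# ≈ 0#)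
                      (e h : Carrier) (h³≈e²+e+1 : h ^ 3 ≈ e ^ 2 + e + 1#) (e≉0 : ¬ e ≈ 0#) (h≉0 : ¬ h ≈ 0#) where

    open PrimitiveCubeRoot ω ω²+ω+1≈0 public

    cubic : Carrier → Carrier
    cubic x = x ^ 3 + (h ^ 2) * x ^ 2 + (e + 1#) * h * x + 1#

    root : Carrier → Carrier → Carrier → Carrier
    root σ u u′ = h ^ 2 + e * (σ * u + σ ^ 2 * u′)

    private
      :cubic : ∀ {n} → Polynomial n → Polynomial n → Polynomial n → Polynomial n
      :cubic h e x = x :^ 3 :+ h :^ 2 :* x :^ 2 :+ (e :+ :1) :* h :* x :+ :1

      :root : ∀ {n} → Polynomial n → Polynomial n → Polynomial n → Polynomial n → Polynomial n → Polynomial n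
      :root h e σ u u′ = h :^ 2 :+ e :* (σ :* u :+ σ :^ 2 :* u′)

    h³≈[e+ω][e+ω²] : h ^ 3 ≈ (e + ω) * (e + ω ^ 2)
    h³≈[e+ω][e+ω²] = trans h³≈e²+e+1 (solve 1 (λ e → e :^ 2 :+ e :+ :1 := (e :+ :ω) :* (e :+ :ω²)) refl e)

    e+ω≉0 : ¬ e + ω ≈ 0#
    e+ω≉0 e+ω≈0 = h≉0 (^≈0⇒≈0 2 (begin
      h ^ 3                  ≈⟨ h³≈[e+ω][e+ω²] ⟩
      (e + ω) * (e + ω ^ 2)  ≈⟨ *-congʳ e+ω≈0 ⟩
      0# * (e + ω ^ 2)       ≈⟨ zeroˡ _ ⟩
      0#                     ∎))

    -- (u , u′) are the two cube roots in Cardano's formula for the roots σ u + σ² u′ of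
    -- T³ + h T + 1, so that the roots of the cubic are h² + e (σ u + σ² u′) with σ³ = 1.
    record IsCardanoPair (u u′ : Carrier) : Set r where
      field
        cube    : u ^ 3 ≈ e + ω
        product : u * u′ ≈ h

      cube′ : u′ ^ 3 ≈ e + ω ^ 2
      cube′ = *-cancelˡ e+ω≉0 (begin
        (e + ω) * u′ ^ 3       ≈⟨ *-congʳ cube ⟨
        u ^ 3 * u′ ^ 3         ≈⟨ ^-distrib-* u u′ 3 ⟨
        (u * u′) ^ 3           ≈⟨ ^-congˡ 3 product ⟩
        h ^ 3                  ≈⟨ h³≈[e+ω][e+ω²] ⟩
        (e + ω) * (e + ω ^ 2)  ∎)

      nonzero : ¬ u ≈ 0#
      nonzero u≈0 = e+ω≉0 (begin
        e + ω   ≈⟨ cube ⟨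
        u ^ 3   ≈⟨ ^-congˡ 3 u≈0 ⟩
        0# ^ 3  ≈⟨ 0^n≈0 3 ⟩
        0#      ∎)

    open IsCardanoPair public

    rotate : ∀ {σ u u′} → σ ^ 3 ≈ 1# → IsCardanoPair u u′ → IsCardanoPair (σ * u) (σ ^ 2 * u′)
    rotate {σ} {u} {u′} σ³≈1 p = record
      { cube    = begin
          (σ * u) ^ 3    ≈⟨ ^-distrib-* σ u 3 ⟩
          σ ^ 3 * u ^ 3  ≈⟨ *-cong σ³≈1 (cube p) ⟩
          1# * (e + ω)   ≈⟨ *-identityˡ _ ⟩
          e + ω          ∎
      ; product = begin
          σ * u * (σ ^ 2 * u′)  ≈⟨ solve 3 (λ σ u u′ → σ :* u :* (σ :^ 2 :* u′) := σ :^ 3 :* (u :* u′)) refl σ u u′ ⟩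
          σ ^ 3 * (u * u′)      ≈⟨ *-cong σ³≈1 (product p) ⟩
          1# * h                ≈⟨ *-identityˡ h ⟩
          h                     ∎
      }

    unique-up-to-μ₃ : ∀ {u u′ v v′} → IsCardanoPair u u′ → IsCardanoPair v v′ →
                      ∃[ ρ ] ρ ^ 3 ≈ 1# × v ≈ ρ * u × v′ ≈ ρ ^ 2 * u′
    unique-up-to-μ₃ {u} {u′} {v} {v′} p q = scale (inverse u (nonzero p))
      where
      scale : ∃[ u⁻¹ ] u * u⁻¹ ≈ 1# → ∃[ ρ ] ρ ^ 3 ≈ 1# × v ≈ ρ * u × v′ ≈ ρ ^ 2 * u′
      scale (u⁻¹ , uu⁻¹≈1) = ρ , ρ³≈1 , v≈ρu , v′≈ρ²u′
        where
        ρ = v * u⁻¹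

        ρ³≈1 : ρ ^ 3 ≈ 1#
        ρ³≈1 = begin
          (v * u⁻¹) ^ 3    ≈⟨ ^-distrib-* v u⁻¹ 3 ⟩
          v ^ 3 * u⁻¹ ^ 3  ≈⟨ *-congʳ (trans (cube q) (sym (cube p))) ⟩
          u ^ 3 * u⁻¹ ^ 3  ≈⟨ ^-distrib-* u u⁻¹ 3 ⟨
          (u * u⁻¹) ^ 3    ≈⟨ ^-congˡ 3 uu⁻¹≈1 ⟩
          1# ^ 3           ≈⟨ 1^n≈1 3 ⟩
          1#               ∎

        v≈ρu : v ≈ ρ * u
        v≈ρu = begin
          v              ≈⟨ *-identityʳ v ⟨
          v * 1#         ≈⟨ *-congˡ uu⁻¹≈1 ⟨
          v * (u * u⁻¹)  ≈⟨ solve 3 (λ v u w → v :* (u :* w) := v :* w :* u) refl v u u⁻¹ ⟩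
          v * u⁻¹ * u    ∎

        ρv′≈u′ : ρ * v′ ≈ u′
        ρv′≈u′ = *-cancelˡ (nonzero p) (begin
          u * (ρ * v′)  ≈⟨ solve 3 (λ u ρ v′ → u :* (ρ :* v′) := ρ :* u :* v′) refl u ρ v′ ⟩
          ρ * u * v′    ≈⟨ *-congʳ v≈ρu ⟨
          v * v′        ≈⟨ product q ⟩
          h             ≈⟨ product p ⟨
          u * u′        ∎)

        v′≈ρ²u′ : v′ ≈ ρ ^ 2 * u′
        v′≈ρ²u′ = begin
          v′                ≈⟨ *-identityˡ v′ ⟨
          1# * v′           ≈⟨ *-congʳ ρ³≈1 ⟨
          ρ ^ 3 * v′        ≈⟨ solve 2 (λ ρ v′ → ρ :^ 3 :* v′ := ρ :^ 2 :* (ρ :* v′)) refl ρ v′ ⟩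
          ρ ^ 2 * (ρ * v′)  ≈⟨ *-congˡ ρv′≈u′ ⟩
          ρ ^ 2 * u′        ∎

    root-congˡ : ∀ {σ τ} u u′ → σ ≈ τ → root σ u u′ ≈ root τ u u′
    root-congˡ u u′ σ≈τ = +-congˡ (*-congˡ (+-cong (*-congʳ σ≈τ) (*-congʳ (^-congˡ 2 σ≈τ))))

    root-rotate : ∀ σ τ u u′ → root τ (σ * u) (σ ^ 2 * u′) ≈ root (σ * τ) u u′
    root-rotate σ τ u u′ = +-congˡ (*-congˡ (solve 4 (λ σ τ u u′ →
      τ :* (σ :* u) :+ τ :^ 2 :* (σ :^ 2 :* u′) := σ :* τ :* u :+ (σ :* τ) :^ 2 :* u′) refl σ τ u u′))

    cubic-shift : ∀ x → cubic x ≈ (x + h ^ 2) ^ 3 + h * e ^ 2 * (x + h ^ 2) + e ^ 3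
    cubic-shift x = modulo h³≈e²+e+1 (solve 3 (λ x h e →
      :cubic h e x := (x :+ h :^ 2) :^ 3 :+ h :* e :^ 2 :* (x :+ h :^ 2) :+ e :^ 3
                      :+ (h :^ 3 :+ (e :^ 2 :+ e :+ :1)) :* (h :* x :+ h :^ 3 :+ e :+ :1)) refl x h e)

    -- Cardano's formula, applied to the shifted cubic (x + h²)³ + h e² (x + h²) + e³.
    cubic-factorisation : ∀ {u u′} → IsCardanoPair u u′ → ∀ x →
                          cubic x ≈ (x + root 1# u u′) * (x + root ω u u′) * (x + root (ω ^ 2) u u′)
    cubic-factorisation {u} {u′} p x = sym (begin
      (x + root 1# u u′) * (x + root ω u u′) * (x + root (ω ^ 2) u u′)
        ≈⟨ solve 5 (λ x h e u u′ →
             (x :+ :root h e :1 u u′) :* (x :+ :root h e :ω u u′) :* (x :+ :root h e :ω² u u′)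
             := (x :+ h :^ 2) :^ 3 :+ e :^ 2 :* (u :* u′) :* (x :+ h :^ 2) :+ e :^ 3 :* (u :^ 3 :+ u′ :^ 3))
             refl x h e u u′ ⟩
      (x + h ^ 2) ^ 3 + e ^ 2 * (u * u′) * (x + h ^ 2) + e ^ 3 * (u ^ 3 + u′ ^ 3)
        ≈⟨ +-cong (+-congˡ (*-congʳ (*-congˡ (product p)))) (*-congˡ (+-cong (cube p) (cube′ p))) ⟩
      (x + h ^ 2) ^ 3 + e ^ 2 * h * (x + h ^ 2) + e ^ 3 * (e + ω + (e + ω ^ 2))
        ≈⟨ solve 3 (λ x h e →
             (x :+ h :^ 2) :^ 3 :+ e :^ 2 :* h :* (x :+ h :^ 2) :+ e :^ 3 :* (e :+ :ω :+ (e :+ :ω²))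
             := (x :+ h :^ 2) :^ 3 :+ h :* e :^ 2 :* (x :+ h :^ 2) :+ e :^ 3) refl x h e ⟩
      (x + h ^ 2) ^ 3 + h * e ^ 2 * (x + h ^ 2) + e ^ 3
        ≈⟨ cubic-shift x ⟨
      cubic x ∎)

    root-product : ∀ {u u′} → IsCardanoPair u u′ → root 1# u u′ * root ω u u′ * root (ω ^ 2) u u′ ≈ 1#
    root-product {u} {u′} p = begin
      x₁ * x₂ * x₃                       ≈⟨ solve 3 (λ a b c → a :* b :* c := (:0 :+ a) :* (:0 :+ b) :* (:0 :+ c)) refl x₁ x₂ x₃ ⟩
      (0# + x₁) * (0# + x₂) * (0# + x₃)  ≈⟨ cubic-factorisation p 0# ⟨
      cubic 0#                           ≈⟨ solve 2 (λ h e → :cubic h e :0 := :1) refl h e ⟩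
      1#                                 ∎
      where
      x₁ = root 1# u u′
      x₂ = root ω u u′
      x₃ = root (ω ^ 2) u u′

    -- The identity that singles out the cyclic order x₁ ↦ x_ω of the roots; writing e and h
    -- through u, it holds modulo the single relation u′³ = u³ + 1 (certificate by division).
    root-orientation : ∀ {u u′} → IsCardanoPair u u′ → root 1# u u′ * root ω u u′ ^ 2 + h * root 1# u u′ + e ≈ 0#
    root-orientation {u} {u′} p = begin
      root 1# u u′ * root ω u u′ ^ 2 + h * root 1# u u′ + e
        ≈⟨ +-cong (+-cong (*-cong (root≈X 1#) (^-congˡ 2 (root≈X ω))) (*-cong h≈uu′ (root≈X 1#))) e≈u³+ω ⟩
      X 1# * X ω ^ 2 + u * u′ * X 1# + (u ^ 3 + ω)
        ≈⟨ modulo u′³≈u³+1 (solve 2 (λ u u′ → let :X = λ s → :root (u :* u′) (u :^ 3 :+ :ω) s u u′ in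
             :X :1 :* :X :ω :^ 2 :+ u :* u′ :* :X :1 :+ (u :^ 3 :+ :ω)
             := :0 :+ (u′ :^ 3 :+ (u :^ 3 :+ :1))
                      :* (u′ :^ 3 :* u :^ 6 :+ u′ :^ 2 :* u :^ 7 :+ :ω :* u′ :^ 2 :* u :^ 4 :+ :ω² :* u′ :* u :^ 8
                          :+ :ω :* u′ :* u :^ 5 :+ u′ :* u :^ 2 :+ :ω² :* u :^ 9 :+ :ω :* u :^ 6 :+ :ω))
             refl u u′) ⟩
      0# ∎
      where
      X : Carrier → Carrier
      X σ = (u * u′) ^ 2 + (u ^ 3 + ω) * (σ * u + σ ^ 2 * u′)

      h≈uu′ : h ≈ u * u′
      h≈uu′ = sym (product p)

      e≈u³+ω : e ≈ u ^ 3 + ω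
      e≈u³+ω = x+y≈z⇒x≈z+y (sym (cube p))

      root≈X : ∀ σ → root σ u u′ ≈ X σ
      root≈X σ = +-cong (^-congˡ 2 h≈uu′) (*-congʳ e≈u³+ω)

      u′³≈u³+1 : u′ ^ 3 ≈ u ^ 3 + 1#
      u′³≈u³+1 = begin
        u′ ^ 3              ≈⟨ cube′ p ⟩
        e + ω ^ 2           ≈⟨ +-congʳ e≈u³+ω ⟩
        u ^ 3 + ω + ω ^ 2   ≈⟨ solve 1 (λ x → x :+ :ω :+ :ω² := x :+ :1) refl (u ^ 3) ⟩
        u ^ 3 + 1#          ∎

    distinct-roots : ∀ {σ τ u u′} → IsCardanoPair u u′ → σ ^ 3 ≈ 1# → τ ^ 3 ≈ 1# → ¬ σ ≈ τ →
                     ¬ root σ u u′ ≈ root τ u u′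
    distinct-roots {σ} {τ} {u} {u′} p σ³≈1 τ³≈1 σ≉τ rσ≈rτ = ω≉ω² (+-cancelˡ e ω (ω ^ 2) (begin
      e + ω                 ≈⟨ cube p ⟨
      u ^ 3                 ≈⟨ ^-congˡ 3 u≈[σ+τ]u′ ⟩
      ((σ + τ) * u′) ^ 3    ≈⟨ ^-distrib-* (σ + τ) u′ 3 ⟩
      (σ + τ) ^ 3 * u′ ^ 3  ≈⟨ *-cong (μ₃-+-cube σ³≈1 τ³≈1 σ≉τ) (cube′ p) ⟩
      1# * (e + ω ^ 2)      ≈⟨ *-identityˡ _ ⟩
      e + ω ^ 2             ∎))
      where
      factorised : e * ((σ + τ) * (u + (σ + τ) * u′)) ≈ 0#
      factorised = trans (solve 6 (λ h e σ τ u u′ →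
        e :* ((σ :+ τ) :* (u :+ (σ :+ τ) :* u′)) := :root h e σ u u′ :+ :root h e τ u u′) refl h e σ τ u u′)
        (x≈y⇒x+y≈0 rσ≈rτ)

      u≈[σ+τ]u′ : u ≈ (σ + τ) * u′
      u≈[σ+τ]u′ = [ (λ e≈0 → contradiction e≈0 e≉0)
                  , [ (λ σ+τ≈0 → contradiction (x+y≈0⇒x≈y σ+τ≈0) σ≉τ) , x+y≈0⇒x≈y ]′ ∘ *-integral
                  ]′ (*-integral factorised)

    root-injective : ∀ {σ τ u u′} → IsCardanoPair u u′ → σ ^ 3 ≈ 1# → τ ^ 3 ≈ 1# →
                     root σ u u′ ≈ root τ u u′ → σ ≈ τ
    root-injective {σ} {τ} p σ³≈1 τ³≈1 rσ≈rτ =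
      decidable-stable (σ ≟ τ) (λ σ≉τ → distinct-roots p σ³≈1 τ³≈1 σ≉τ rσ≈rτ)

    cubic-roots : ∀ {u u′ x} → IsCardanoPair u u′ → cubic x ≈ 0# →
                  x ≈ root 1# u u′ ⊎ x ≈ root ω u u′ ⊎ x ≈ root (ω ^ 2) u u′
    cubic-roots p cubic≈0 = Data.Sum.map x+y≈0⇒x≈y (Data.Sum.map x+y≈0⇒x≈y x+y≈0⇒x≈y)
      (*-integral₃ (trans (sym (cubic-factorisation p _)) cubic≈0))

    cubic-cong : ∀ {x y} → x ≈ y → cubic x ≈ cubic y
    cubic-cong x≈y = +-congʳ (+-cong (+-cong (^-congˡ 3 x≈y) (*-congˡ (^-congˡ 2 x≈y))) (*-congˡ x≈y))

    root-of-cubic : ∀ {u u′} → IsCardanoPair u u′ → cubic (root 1# u u′) ≈ 0#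
    root-of-cubic {u} {u′} p = begin
      cubic x₁                                           ≈⟨ cubic-factorisation p x₁ ⟩
      (x₁ + x₁) * (x₁ + root ω u u′) * (x₁ + root (ω ^ 2) u u′)  ≈⟨ *-congʳ (*-congʳ (x+x≈0 x₁)) ⟩
      0# * (x₁ + root ω u u′) * (x₁ + root (ω ^ 2) u u′)  ≈⟨ *-congʳ (zeroˡ _) ⟩
      0# * (x₁ + root (ω ^ 2) u u′)                       ≈⟨ zeroˡ _ ⟩
      0#                                                  ∎
      where x₁ = root 1# u u′

    cubic-from-orbit : ∀ {x y z} → x * y * z ≈ 1# → x * y ^ 2 + h * x + e ≈ 0# → z * x ^ 2 + h * z + e ≈ 0# →
                       (x + h ^ 2) * cubic x ≈ 0#
    cubic-from-orbit {x} {y} {z} xyz≈1 A B = begin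
      (x + h ^ 2) * cubic x
        ≈⟨ modulo h³≈e²+e+1 (solve 3 (λ x h e →
             (x :+ h :^ 2) :* :cubic h e x
             := x :^ 4 :+ h :* e :^ 2 :* x :^ 2 :+ e :^ 3 :* x :+ h :^ 2
                :+ (h :^ 3 :+ (e :^ 2 :+ e :+ :1)) :* (h :* x :^ 2 :+ (e :+ :1) :* x)) refl x h e) ⟩
      x ^ 4 + h * e ^ 2 * x ^ 2 + e ^ 3 * x + h ^ 2
        ≈⟨ solve 3 (λ x h e → x :^ 4 :+ h :* e :^ 2 :* x :^ 2 :+ e :^ 3 :* x :+ h :^ 2
                              := (x :^ 2 :+ h) :^ 2 :+ e :^ 2 :* (x :* (h :* x :+ e))) refl x h e ⟩
      (x ^ 2 + h) ^ 2 + e ^ 2 * (x * (h * x + e))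
        ≈⟨ +-congˡ (*-cong (^-congˡ 2 e≈z[x²+h]) (*-congˡ (sym xy²≈hx+e))) ⟩
      (x ^ 2 + h) ^ 2 + (z * (x ^ 2 + h)) ^ 2 * (x * (x * y ^ 2))
        ≈⟨ solve 4 (λ x y z h → (x :^ 2 :+ h) :^ 2 :+ (z :* (x :^ 2 :+ h)) :^ 2 :* (x :* (x :* y :^ 2))
                                := (x :^ 2 :+ h) :^ 2 :* (:1 :+ (x :* y :* z) :^ 2)) refl x y z h ⟩
      (x ^ 2 + h) ^ 2 * (1# + (x * y * z) ^ 2)
        ≈⟨ *-congˡ (trans (+-congˡ (^-congˡ 2 xyz≈1)) (solve 0 (:1 :+ :1 :^ 2 := :0) refl)) ⟩
      (x ^ 2 + h) ^ 2 * 0#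
        ≈⟨ zeroʳ _ ⟩
      0# ∎
      where
      xy²≈hx+e : x * y ^ 2 ≈ h * x + e
      xy²≈hx+e = x+y+z≈0⇒x≈y+z A

      e≈z[x²+h] : e ≈ z * (x ^ 2 + h)
      e≈z[x²+h] = begin
        e                  ≈⟨ x+y≈0⇒x≈y B ⟨
        z * x ^ 2 + h * z  ≈⟨ +-congˡ (*-comm h z) ⟩
        z * x ^ 2 + z * h  ≈⟨ distribˡ z (x ^ 2) h ⟨
        z * (x ^ 2 + h)    ∎

    module PairsFromωc (se sh b c : Carrier) (se²≈e : se * se ≈ e) (sh²≈h : sh * sh ≈ h)
                          (bse≈1 : b * se ≈ 1#) (c[b+ω²]≈b+ω : c * (b + ω ^ 2) ≈ b + ω) where

      c²[1+ωe]≈1+ω²e : c ^ 2 * (1# + ω * e) ≈ 1# + ω ^ 2 * e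
      c²[1+ωe]≈1+ω²e = begin
        c ^ 2 * (1# + ω * e)          ≈⟨ *-congˡ (+-congˡ (*-congˡ se²≈e)) ⟨
        c ^ 2 * (1# + ω * (se * se))  ≈⟨ solve 2 (λ c s → c :^ 2 :* (:1 :+ :ω :* (s :* s)) := (c :* (:1 :+ :ω² :* s)) :^ 2) refl c se ⟩
        (c * (1# + ω ^ 2 * se)) ^ 2   ≈⟨ ^-congˡ 2 c[1+ω²se]≈1+ωse ⟩
        (1# + ω * se) ^ 2             ≈⟨ solve 1 (λ s → (:1 :+ :ω :* s) :^ 2 := :1 :+ :ω² :* (s :* s)) refl se ⟩
        1# + ω ^ 2 * (se * se)        ≈⟨ +-congˡ (*-congˡ se²≈e) ⟩
        1# + ω ^ 2 * e                ∎
        where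
        c[1+ω²se]≈1+ωse : c * (1# + ω ^ 2 * se) ≈ 1# + ω * se
        c[1+ω²se]≈1+ωse = begin
          c * (1# + ω ^ 2 * se)  ≈⟨ modulo bse≈1 (solve 3 (λ b c s → c :* (:1 :+ :ω² :* s)
                                      := c :* (b :+ :ω²) :* s :+ (b :* s :+ :1) :* c) refl b c se) ⟩
          c * (b + ω ^ 2) * se   ≈⟨ *-congʳ c[b+ω²]≈b+ω ⟩
          (b + ω) * se           ≈⟨ modulo bse≈1 (solve 2 (λ b s → (b :+ :ω) :* s
                                      := :1 :+ :ω :* s :+ (b :* s :+ :1) :* :1) refl b se) ⟩
          1# + ω * se            ∎

      ωc·sh³≈e+ω : ω * c * sh ^ 3 ≈ e + ω
      ωc·sh³≈e+ω = ^2-injective (begin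
        (ω * c * sh ^ 3) ^ 2                        ≈⟨ solve 2 (λ c s → (:ω :* c :* s :^ 3) :^ 2 := :ω² :* c :^ 2 :* (s :* s) :^ 3) refl c sh ⟩
        ω ^ 2 * c ^ 2 * (sh * sh) ^ 3               ≈⟨ *-congˡ (^-congˡ 3 sh²≈h) ⟩
        ω ^ 2 * c ^ 2 * h ^ 3                       ≈⟨ *-congˡ h³≈[e+ω][e+ω²] ⟩
        ω ^ 2 * c ^ 2 * ((e + ω) * (e + ω ^ 2))     ≈⟨ solve 2 (λ c e → :ω² :* c :^ 2 :* ((e :+ :ω) :* (e :+ :ω²))
                                                          := c :^ 2 :* (:1 :+ :ω :* e) :* (:ω :* (e :+ :ω))) refl c e ⟩
        c ^ 2 * (1# + ω * e) * (ω * (e + ω))        ≈⟨ *-congʳ c²[1+ωe]≈1+ω²e ⟩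
        (1# + ω ^ 2 * e) * (ω * (e + ω))            ≈⟨ solve 1 (λ e → (:1 :+ :ω² :* e) :* (:ω :* (e :+ :ω)) := (e :+ :ω) :^ 2) refl e ⟩
        (e + ω) ^ 2                                 ∎)

      cube-roots-of-ωc : ∀ {v w} → v ^ 3 ≈ ω * c → v * w ≈ 1# → IsCardanoPair (sh * v) (sh * w)
      cube-roots-of-ωc {v} {w} v³≈ωc vw≈1 = record
        { cube    = begin
            (sh * v) ^ 3      ≈⟨ ^-distrib-* sh v 3 ⟩
            sh ^ 3 * v ^ 3    ≈⟨ *-congˡ v³≈ωc ⟩
            sh ^ 3 * (ω * c)  ≈⟨ *-comm _ _ ⟩
            ω * c * sh ^ 3    ≈⟨ ωc·sh³≈e+ω ⟩
            e + ω             ∎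
        ; product = begin
            sh * v * (sh * w)    ≈⟨ solve 3 (λ s v w → s :* v :* (s :* w) := s :* s :* (v :* w)) refl sh v w ⟩
            sh * sh * (v * w)    ≈⟨ *-cong sh²≈h vw≈1 ⟩
            h * 1#               ≈⟨ *-identityʳ h ⟩
            h                    ∎
        }

      ωc≉0 : ¬ ω * c ≈ 0#
      ωc≉0 ωc≈0 = e+ω≉0 (begin
        e + ω           ≈⟨ ωc·sh³≈e+ω ⟨
        ω * c * sh ^ 3  ≈⟨ *-congʳ ωc≈0 ⟩
        0# * sh ^ 3     ≈⟨ zeroˡ _ ⟩
        0#              ∎)

      cube-root-of-ωc : ∃[ v ] ∃[ w ] v ^ 3 ≈ ω * c × v * w ≈ 1#
      cube-root-of-ωc = invert (cube-root (ω * c))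
        where
        invert : ∃[ v ] v ^ 3 ≈ ω * c → ∃[ v ] ∃[ w ] v ^ 3 ≈ ω * c × v * w ≈ 1#
        invert (v , v³≈ωc) = v , proj₁ v⁻¹ , v³≈ωc , proj₂ v⁻¹
          where
          v⁻¹ = inverse v (λ v≈0 → ωc≉0 (trans (sym v³≈ωc) (trans (^-congˡ 3 v≈0) (0^n≈0 3))))

    module Frobenius (m : ℕ) (hᵠ≈h : h ^ 2 ℕ.^ m ≈ h) (eᵠ≈e : e ^ 2 ℕ.^ m ≈ e) where

      q : ℕ
      q = 2 ℕ.^ m

      instance
        q≢0 : ℕ.NonZero q
        q≢0 = ℕ.m^n≢0 2 m

      ^q-fixed : ∀ {x} n → x ^ q ≈ x → (x ^ n) ^ q ≈ x ^ n
      ^q-fixed {x} n xᵠ≈x = trans (^-comm x n q) (^-congˡ n xᵠ≈x)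

      root-^q : ∀ σ u u′ → root σ u u′ ^ q ≈ h ^ 2 + e * (σ ^ q * u ^ q + (σ ^ 2) ^ q * u′ ^ q)
      root-^q σ u u′ = begin
        (h ^ 2 + e * (σ * u + σ ^ 2 * u′)) ^ q          ≈⟨ frobenius-+ m (h ^ 2) _ ⟩
        (h ^ 2) ^ q + (e * (σ * u + σ ^ 2 * u′)) ^ q    ≈⟨ +-cong (^q-fixed 2 hᵠ≈h) (^-distrib-* e _ q) ⟩
        h ^ 2 + e ^ q * (σ * u + σ ^ 2 * u′) ^ q        ≈⟨ +-congˡ (*-cong eᵠ≈e (frobenius-+ m (σ * u) (σ ^ 2 * u′))) ⟩
        h ^ 2 + e * ((σ * u) ^ q + (σ ^ 2 * u′) ^ q)    ≈⟨ +-congˡ (*-congˡ (+-cong (^-distrib-* σ u q) (^-distrib-* (σ ^ 2) u′ q))) ⟩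
        h ^ 2 + e * (σ ^ q * u ^ q + (σ ^ 2) ^ q * u′ ^ q) ∎

      frobenius-G : ∀ {x y} → x * y ^ 2 + h * x + e ≈ 0# → x ^ q * (y ^ q) ^ 2 + h * x ^ q + e ≈ 0#
      frobenius-G {x} {y} G≈0 = begin
        x ^ q * (y ^ q) ^ 2 + h * x ^ q + e              ≈⟨ +-cong (+-cong (*-congˡ (^-comm y 2 q)) (*-congʳ hᵠ≈h)) eᵠ≈e ⟨
        x ^ q * (y ^ 2) ^ q + h ^ q * x ^ q + e ^ q      ≈⟨ +-congʳ (+-cong (^-distrib-* x (y ^ 2) q) (^-distrib-* h x q)) ⟨
        (x * y ^ 2) ^ q + (h * x) ^ q + e ^ q            ≈⟨ +-congʳ (frobenius-+ m (x * y ^ 2) (h * x)) ⟨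
        (x * y ^ 2 + h * x) ^ q + e ^ q                  ≈⟨ frobenius-+ m (x * y ^ 2 + h * x) e ⟨
        (x * y ^ 2 + h * x + e) ^ q                      ≈⟨ ^-congˡ q G≈0 ⟩
        0# ^ q                                           ≈⟨ 0^n≈0 q ⟩
        0#                                               ∎

      μ-expand : ∀ x → x ^ (q ℕ.* q ℕ.+ q ℕ.+ 1) ≈ (x ^ q) ^ q * x ^ q * x
      μ-expand x = begin
        x ^ (q ℕ.* q ℕ.+ q ℕ.+ 1)        ≈⟨ ^-homo-* x (q ℕ.* q ℕ.+ q) 1 ⟩
        x ^ (q ℕ.* q ℕ.+ q) * x ^ 1      ≈⟨ *-cong (^-homo-* x (q ℕ.* q) q) (*-identityʳ x) ⟩
        x ^ (q ℕ.* q) * x ^ q * x        ≈⟨ *-congʳ (*-congʳ (^-assocʳ x q q)) ⟨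
        (x ^ q) ^ q * x ^ q * x          ∎

      record FrobeniusRotation {u u′ : Carrier} (p : IsCardanoPair u u′) (ρ : Carrier) : Set (a ⊔ r) where
        field
          ρ³≈1     : ρ ^ 3 ≈ 1#
          on-roots : ∀ {σ} → σ ^ 3 ≈ 1# → root σ u u′ ^ q ≈ root (σ * ρ) u u′
          on-u     : u ^ (q ℕ.* q) ≈ ρ ^ 2 * u

      μ₃-^q : ∀ {σ r} → q % 3 ≡ r → σ ^ 3 ≈ 1# → σ ^ q ≈ σ ^ r
      μ₃-^q {σ} q%3≡r σ³≈1 = trans (μ₃-^-% σ³≈1 q) (^-congʳ σ q%3≡r)

      frobenius-pair : ∀ {u u′} → IsCardanoPair u u′ → q % 3 ≡ 1 → IsCardanoPair (u ^ q) (u′ ^ q)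
      frobenius-pair {u} {u′} p q%3≡1 = record
        { cube    = begin
            (u ^ q) ^ 3    ≈⟨ ^-comm u q 3 ⟩
            (u ^ 3) ^ q    ≈⟨ ^-congˡ q (cube p) ⟩
            (e + ω) ^ q    ≈⟨ frobenius-+ m e ω ⟩
            e ^ q + ω ^ q  ≈⟨ +-cong eᵠ≈e (trans (μ₃-^q q%3≡1 ω³≈1) (*-identityʳ ω)) ⟩
            e + ω          ∎
        ; product = trans (sym (^-distrib-* u u′ q)) (trans (^-congˡ q (product p)) hᵠ≈h)
        }

      frobenius-pair-swapped : ∀ {u u′} → IsCardanoPair u u′ → q % 3 ≡ 2 → IsCardanoPair (u′ ^ q) (u ^ q)
      frobenius-pair-swapped {u} {u′} p q%3≡2 = record
        { cube    = begin
            (u′ ^ q) ^ 3         ≈⟨ ^-comm u′ q 3 ⟩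
            (u′ ^ 3) ^ q         ≈⟨ ^-congˡ q (cube′ p) ⟩
            (e + ω ^ 2) ^ q      ≈⟨ frobenius-+ m e (ω ^ 2) ⟩
            e ^ q + (ω ^ 2) ^ q  ≈⟨ +-cong eᵠ≈e (μ₃-^q q%3≡2 (μ₃-^ ω³≈1 2)) ⟩
            e + (ω ^ 2) ^ 2      ≈⟨ +-congˡ (solve 0 (:ω² :^ 2 := :ω) refl) ⟩
            e + ω                ∎
        ; product = begin
            u′ ^ q * u ^ q  ≈⟨ ^-distrib-* u′ u q ⟨
            (u′ * u) ^ q    ≈⟨ ^-congˡ q (trans (*-comm u′ u) (product p)) ⟩
            h ^ q           ≈⟨ hᵠ≈h ⟩
            h               ∎
        }

      rotation-fixing-ω : ∀ {u u′} (p : IsCardanoPair u u′) → q % 3 ≡ 1 → ∃ (FrobeniusRotation p)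
      rotation-fixing-ω {u} {u′} p q%3≡1 = rotation (unique-up-to-μ₃ p (frobenius-pair p q%3≡1))
        where
        σᵠ≈σ : ∀ {σ} → σ ^ 3 ≈ 1# → σ ^ q ≈ σ
        σᵠ≈σ {σ} σ³≈1 = trans (μ₃-^q q%3≡1 σ³≈1) (*-identityʳ σ)

        rotation : ∃[ ρ ] ρ ^ 3 ≈ 1# × u ^ q ≈ ρ * u × u′ ^ q ≈ ρ ^ 2 * u′ → ∃ (FrobeniusRotation p)
        rotation (ρ , ρ³≈1 , uᵠ≈ρu , u′ᵠ≈ρ²u′) = ρ , record
          { ρ³≈1     = ρ³≈1
          ; on-roots = λ {σ} σ³≈1 → begin
              root σ u u′ ^ q
                ≈⟨ root-^q σ u u′ ⟩
              h ^ 2 + e * (σ ^ q * u ^ q + (σ ^ 2) ^ q * u′ ^ q)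
                ≈⟨ +-congˡ (*-congˡ (+-cong (*-cong (σᵠ≈σ σ³≈1) uᵠ≈ρu) (*-cong (σᵠ≈σ (μ₃-^ σ³≈1 2)) u′ᵠ≈ρ²u′))) ⟩
              h ^ 2 + e * (σ * (ρ * u) + σ ^ 2 * (ρ ^ 2 * u′))
                ≈⟨ +-congˡ (*-congˡ (solve 4 (λ σ ρ u u′ → σ :* (ρ :* u) :+ σ :^ 2 :* (ρ :^ 2 :* u′)
                                                        := σ :* ρ :* u :+ (σ :* ρ) :^ 2 :* u′) refl σ ρ u u′)) ⟩
              root (σ * ρ) u u′ ∎
          ; on-u     = begin
              u ^ (q ℕ.* q)  ≈⟨ ^-assocʳ u q q ⟨
              (u ^ q) ^ q    ≈⟨ ^-congˡ q uᵠ≈ρu ⟩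
              (ρ * u) ^ q    ≈⟨ ^-distrib-* ρ u q ⟩
              ρ ^ q * u ^ q  ≈⟨ *-cong (σᵠ≈σ ρ³≈1) uᵠ≈ρu ⟩
              ρ * (ρ * u)    ≈⟨ solve 2 (λ ρ u → ρ :* (ρ :* u) := ρ :^ 2 :* u) refl ρ u ⟩
              ρ ^ 2 * u      ∎
          }

      rotation-swapping-ω : ∀ {u u′} (p : IsCardanoPair u u′) → q % 3 ≡ 2 → ∃ (FrobeniusRotation p)
      rotation-swapping-ω {u} {u′} p q%3≡2 = rotation (unique-up-to-μ₃ p (frobenius-pair-swapped p q%3≡2))
        where
        σᵠ≈σ² : ∀ {σ} → σ ^ 3 ≈ 1# → σ ^ q ≈ σ ^ 2
        σᵠ≈σ² = μ₃-^q q%3≡2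

        rotation : ∃[ ρ ] ρ ^ 3 ≈ 1# × u′ ^ q ≈ ρ * u × u ^ q ≈ ρ ^ 2 * u′ → ∃ (FrobeniusRotation p)
        rotation (ρ , ρ³≈1 , u′ᵠ≈ρu , uᵠ≈ρ²u′) = ρ , record
          { ρ³≈1     = ρ³≈1
          ; on-roots = λ {σ} σ³≈1 → begin
              root σ u u′ ^ q
                ≈⟨ root-^q σ u u′ ⟩
              h ^ 2 + e * (σ ^ q * u ^ q + (σ ^ 2) ^ q * u′ ^ q)
                ≈⟨ +-congˡ (*-congˡ (+-cong (*-cong (σᵠ≈σ² σ³≈1) uᵠ≈ρ²u′) (*-cong (σᵠ≈σ² (μ₃-^ σ³≈1 2)) u′ᵠ≈ρu))) ⟩
              h ^ 2 + e * (σ ^ 2 * (ρ ^ 2 * u′) + (σ ^ 2) ^ 2 * (ρ * u))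
                ≈⟨ +-congˡ (*-congˡ (modulo σ³≈1 (solve 4 (λ σ ρ u u′ →
                     σ :^ 2 :* (ρ :^ 2 :* u′) :+ (σ :^ 2) :^ 2 :* (ρ :* u)
                     := σ :* ρ :* u :+ (σ :* ρ) :^ 2 :* u′ :+ (σ :^ 3 :+ :1) :* (σ :* ρ :* u)) refl σ ρ u u′))) ⟩
              root (σ * ρ) u u′ ∎
          ; on-u     = begin
              u ^ (q ℕ.* q)          ≈⟨ ^-assocʳ u q q ⟨
              (u ^ q) ^ q            ≈⟨ ^-congˡ q uᵠ≈ρ²u′ ⟩
              (ρ ^ 2 * u′) ^ q       ≈⟨ ^-distrib-* (ρ ^ 2) u′ q ⟩
              (ρ ^ 2) ^ q * u′ ^ q   ≈⟨ *-cong (σᵠ≈σ² (μ₃-^ ρ³≈1 2)) u′ᵠ≈ρu ⟩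
              (ρ ^ 2) ^ 2 * (ρ * u)  ≈⟨ modulo ρ³≈1 (solve 2 (λ ρ u → (ρ :^ 2) :^ 2 :* (ρ :* u)
                                          := ρ :^ 2 :* u :+ (ρ :^ 3 :+ :1) :* (ρ :^ 2 :* u)) refl ρ u) ⟩
              ρ ^ 2 * u              ∎
          }

      frobenius-rotation : ∀ {u u′} (p : IsCardanoPair u u′) → ∃ (FrobeniusRotation p)
      frobenius-rotation p = [ rotation-fixing-ω p , rotation-swapping-ω p ]′ (2^m-unit₃ m)

      module RootsOfG (l : ℕ) (l⊥3 : Coprime l 3) (e≉1 : ¬ e ≈ 1#)
                      {u u′ : Carrier} (p : IsCardanoPair u u′) {ρ : Carrier} (F : FrobeniusRotation p ρ) where

        G : Carrier → Carrier
        G x = x ^ (2 ℕ.* (q ℕ.^ l) ℕ.+ 1) + h * x + e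

        μ : Carrier → Set r
        μ x = x ^ (q ℕ.* q ℕ.+ q ℕ.+ 1) ≈ 1#

        Root : Carrier → Set r
        Root x = μ x × G x ≈ 0#

        Cond : Set r
        Cond = (e + ω) ^ ((q ℕ.* q ∸ 1) / 3) * ω ^ l ≈ 1#

        Three : Set (a ⊔ r)
        Three = ∃[ x₁ ] ∃[ x₂ ] ∃[ x₃ ]
                  (Root x₁ × Root x₂ × Root x₃ ×
                   ¬ (x₁ ≈ x₂) × ¬ (x₁ ≈ x₃) × ¬ (x₂ ≈ x₃) ×
                   (∀ x → Root x → (x ≈ x₁) ⊎ (x ≈ x₂) ⊎ (x ≈ x₃)))

        x[_] : Carrier → Carrier
        x[ σ ] = root σ u u′

        x-cong : ∀ {σ τ} → σ ≈ τ → x[ σ ] ≈ x[ τ ]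
        x-cong = root-congˡ u u′

        open FrobeniusRotation F

        G-cong : ∀ {x y} → x ≈ y → G x ≈ G y
        G-cong x≈y = +-congʳ (+-cong (^-congˡ (2 ℕ.* (q ℕ.^ l) ℕ.+ 1) x≈y) (*-congˡ x≈y))

        Root-cong : ∀ {x y} → x ≈ y → Root x → Root y
        Root-cong x≈y (μx , Gx≈0) = trans (^-congˡ (q ℕ.* q ℕ.+ q ℕ.+ 1) (sym x≈y)) μx , trans (G-cong (sym x≈y)) Gx≈0

        x-^q^n : ∀ n {σ} → σ ^ 3 ≈ 1# → x[ σ ] ^ (q ℕ.^ n) ≈ x[ σ * ρ ^ n ]
        x-^q^n zero    {σ} _    = trans (*-identityʳ _) (x-cong (sym (*-identityʳ σ)))
        x-^q^n (suc n) {σ} σ³≈1 = begin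
          x[ σ ] ^ (q ℕ.* q ℕ.^ n)  ≈⟨ ^-assocʳ x[ σ ] q (q ℕ.^ n) ⟨
          (x[ σ ] ^ q) ^ (q ℕ.^ n)  ≈⟨ ^-congˡ (q ℕ.^ n) (on-roots σ³≈1) ⟩
          x[ σ * ρ ] ^ (q ℕ.^ n)    ≈⟨ x-^q^n n (μ₃-* σ³≈1 ρ³≈1) ⟩
          x[ σ * ρ * ρ ^ n ]        ≈⟨ x-cong (*-assoc σ ρ (ρ ^ n)) ⟩
          x[ σ * ρ ^ suc n ]        ∎

        [e+ω]^[q²-1]/3≈ρ² : (e + ω) ^ ((q ℕ.* q ∸ 1) / 3) ≈ ρ ^ 2
        [e+ω]^[q²-1]/3≈ρ² = *-cancelˡ (nonzero p) (begin
          u * (e + ω) ^ d       ≈⟨ *-comm u _ ⟩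
          (e + ω) ^ d * u       ≈⟨ *-cong (^-congˡ d (cube p)) (*-identityʳ u) ⟨
          (u ^ 3) ^ d * u ^ 1   ≈⟨ *-congʳ (^-assocʳ u 3 d) ⟩
          u ^ (3 ℕ.* d) * u ^ 1 ≈⟨ ^-homo-* u (3 ℕ.* d) 1 ⟨
          u ^ (3 ℕ.* d ℕ.+ 1)   ≈⟨ ^-congʳ u (n%3≡1⇒n≡3*[n∸1]/3+1 (q ℕ.* q) (unit₃-square q (2^m-unit₃ m))) ⟨
          u ^ (q ℕ.* q)         ≈⟨ on-u ⟩
          ρ ^ 2 * u             ≈⟨ *-comm _ u ⟩
          u * ρ ^ 2             ∎)
          where d = (q ℕ.* q ∸ 1) / 3

        cond⇔ρˡ≈ω : Cond ⇔ ρ ^ l ≈ ω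
        cond⇔ρˡ≈ω = mk⇔ (λ cond → to (trans (*-congʳ (sym [e+ω]^[q²-1]/3≈ρ²)) cond))
                        (λ ρˡ≈ω → trans (*-congʳ [e+ω]^[q²-1]/3≈ρ²) (from ρˡ≈ω))
          where open Equivalence (μ₃-twist {l = l} ρ³≈1 (coprime⇒unit₃ l⊥3))

        x-rotated : ∀ {σ} τ → x[ σ * τ ] ≈ root τ (σ * u) (σ ^ 2 * u′)
        x-rotated {σ} τ = sym (root-rotate σ τ u u′)

        x-rotated₁ : ∀ {σ} → x[ σ ] ≈ root 1# (σ * u) (σ ^ 2 * u′)
        x-rotated₁ {σ} = trans (x-cong (sym (*-identityʳ σ))) (x-rotated 1#)

        x-product : ∀ {σ} → σ ^ 3 ≈ 1# → x[ σ ] * x[ σ * ω ] * x[ σ * ω ^ 2 ] ≈ 1#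
        x-product σ³≈1 = trans (*-cong (*-cong x-rotated₁ (x-rotated ω)) (x-rotated (ω ^ 2)))
                               (root-product (rotate σ³≈1 p))

        x-orientation : ∀ {σ} → σ ^ 3 ≈ 1# → x[ σ ] * x[ σ * ω ] ^ 2 + h * x[ σ ] + e ≈ 0#
        x-orientation σ³≈1 = trans (+-congʳ (+-cong (*-cong x-rotated₁ (^-congˡ 2 (x-rotated ω))) (*-congˡ x-rotated₁)))
                                   (root-orientation (rotate σ³≈1 p))

        x-nonzero : ∀ {σ} → σ ^ 3 ≈ 1# → ¬ x[ σ ] ≈ 0#
        x-nonzero {σ} σ³≈1 = *≈1⇒nonzero (trans (sym (*-assoc x[ σ ] _ _)) (x-product σ³≈1))

        G-at : ∀ {σ} → σ ^ 3 ≈ 1# → G x[ σ ] ≈ x[ σ ] * x[ σ * ρ ^ l ] ^ 2 + h * x[ σ ] + e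
        G-at {σ} σ³≈1 = +-congʳ (+-congʳ (trans (^-2n+1 x[ σ ] (q ℕ.^ l)) (*-congˡ (^-congˡ 2 (x-^q^n l σ³≈1)))))

        -- G x_σ = x_σ (x_{σ ρˡ}² + x_{σ ω}²) by orientation, and the roots x_τ are distinct.
        G≈0⇒ρˡ≈ω : ∀ {σ} → σ ^ 3 ≈ 1# → G x[ σ ] ≈ 0# → ρ ^ l ≈ ω
        G≈0⇒ρˡ≈ω {σ} σ³≈1 G≈0 = *-cancelˡ (*≈1⇒nonzero σ³≈1)
          (root-injective p (μ₃-* σ³≈1 (μ₃-^ ρ³≈1 l)) (μ₃-* σ³≈1 ω³≈1)
            (^2-injective (*-cancelˡ (x-nonzero σ³≈1)
              (trans (x+y+z≈0⇒x≈y+z (trans (sym (G-at σ³≈1)) G≈0))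
                     (sym (x+y+z≈0⇒x≈y+z (x-orientation σ³≈1)))))))

        ρˡ≈ω⇒ρ≉1 : ρ ^ l ≈ ω → ¬ ρ ≈ 1#
        ρˡ≈ω⇒ρ≉1 ρˡ≈ω ρ≈1 = ω≉1 (trans (sym ρˡ≈ω) (trans (^-congˡ l ρ≈1) (1^n≈1 l)))

        -- For ρ ≠ 1 the Frobenius orbit of x_σ consists of all three roots.
        x-orbit-product : ∀ {σ} → σ ^ 3 ≈ 1# → ¬ ρ ≈ 1# → x[ σ * (ρ * ρ) ] * x[ σ * ρ ] * x[ σ ] ≈ 1#
        x-orbit-product {σ} σ³≈1 ρ≉1 = [ (λ ρ≈1 → contradiction ρ≈1 ρ≉1) , [ ρ≈ω⇒ , ρ≈ω²⇒ ]′ ]′ (μ₃-classification ρ³≈1)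
          where
          x-cong₂ : ∀ {α β γ δ} → α ≈ γ → β ≈ δ → x[ σ * α ] * x[ σ * β ] * x[ σ ] ≈ x[ σ * γ ] * x[ σ * δ ] * x[ σ ]
          x-cong₂ α≈γ β≈δ = *-congʳ (*-cong (x-cong (*-congˡ α≈γ)) (x-cong (*-congˡ β≈δ)))

          ρ≈ω⇒ : ρ ≈ ω → x[ σ * (ρ * ρ) ] * x[ σ * ρ ] * x[ σ ] ≈ 1#
          ρ≈ω⇒ ρ≈ω = begin
            x[ σ * (ρ * ρ) ] * x[ σ * ρ ] * x[ σ ]  ≈⟨ x-cong₂ (trans (*-cong ρ≈ω ρ≈ω) (solve 0 (:ω :* :ω := :ω²) refl)) ρ≈ω ⟩
            x[ σ * ω ^ 2 ] * x[ σ * ω ] * x[ σ ]    ≈⟨ solve 3 (λ a b c → a :* b :* c := c :* b :* a) refl _ _ _ ⟩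
            x[ σ ] * x[ σ * ω ] * x[ σ * ω ^ 2 ]    ≈⟨ x-product σ³≈1 ⟩
            1#                                      ∎

          ρ≈ω²⇒ : ρ ≈ ω ^ 2 → x[ σ * (ρ * ρ) ] * x[ σ * ρ ] * x[ σ ] ≈ 1#
          ρ≈ω²⇒ ρ≈ω² = begin
            x[ σ * (ρ * ρ) ] * x[ σ * ρ ] * x[ σ ]  ≈⟨ x-cong₂ (trans (*-cong ρ≈ω² ρ≈ω²) (solve 0 (:ω² :* :ω² := :ω) refl)) ρ≈ω² ⟩
            x[ σ * ω ] * x[ σ * ω ^ 2 ] * x[ σ ]    ≈⟨ solve 3 (λ a b c → a :* b :* c := c :* a :* b) refl _ _ _ ⟩
            x[ σ ] * x[ σ * ω ] * x[ σ * ω ^ 2 ]    ≈⟨ x-product σ³≈1 ⟩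
            1#                                      ∎

        x-μ : ∀ {σ} → σ ^ 3 ≈ 1# → ¬ ρ ≈ 1# → μ x[ σ ]
        x-μ {σ} σ³≈1 ρ≉1 = begin
          x[ σ ] ^ (q ℕ.* q ℕ.+ q ℕ.+ 1)          ≈⟨ μ-expand x[ σ ] ⟩
          (x[ σ ] ^ q) ^ q * x[ σ ] ^ q * x[ σ ]  ≈⟨ *-congʳ (*-cong (trans (^-congˡ q (on-roots σ³≈1)) (on-roots (μ₃-* σ³≈1 ρ³≈1)))
                                                                     (on-roots σ³≈1)) ⟩
          x[ σ * ρ * ρ ] * x[ σ * ρ ] * x[ σ ]    ≈⟨ *-congʳ (*-congʳ (x-cong (*-assoc σ ρ ρ))) ⟩
          x[ σ * (ρ * ρ) ] * x[ σ * ρ ] * x[ σ ]  ≈⟨ x-orbit-product σ³≈1 ρ≉1 ⟩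
          1#                                      ∎

        ρˡ≈ω⇒root : ∀ {σ} → σ ^ 3 ≈ 1# → ρ ^ l ≈ ω → Root x[ σ ]
        ρˡ≈ω⇒root {σ} σ³≈1 ρˡ≈ω = x-μ σ³≈1 (ρˡ≈ω⇒ρ≉1 ρˡ≈ω) , (begin
          G x[ σ ]                                              ≈⟨ G-at σ³≈1 ⟩
          x[ σ ] * x[ σ * ρ ^ l ] ^ 2 + h * x[ σ ] + e          ≈⟨ +-congʳ (+-congʳ (*-congˡ (^-congˡ 2 (x-cong (*-congˡ ρˡ≈ω))))) ⟩
          x[ σ ] * x[ σ * ω ] ^ 2 + h * x[ σ ] + e              ≈⟨ x-orientation σ³≈1 ⟩
          0#                                                    ∎)

        h²∉μ : ¬ μ (h ^ 2)
        h²∉μ μh² = [ e≉0 , e≉1 ]′ (x²+x≈0-roots (begin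
          e ^ 2 + e  ≈⟨ x+y≈z⇒x≈z+y (trans (sym h³≈e²+e+1) h³≈1) ⟩
          1# + 1#    ≈⟨ char2 ⟩
          0#         ∎))
          where
          h²ᵠ≈h² : (h ^ 2) ^ q ≈ h ^ 2
          h²ᵠ≈h² = ^q-fixed 2 hᵠ≈h

          h³≈1 : h ^ 3 ≈ 1#
          h³≈1 = ^2-injective (begin
            (h ^ 3) ^ 2                                ≈⟨ solve 1 (λ h → (h :^ 3) :^ 2 := h :^ 2 :* h :^ 2 :* h :^ 2) refl h ⟩
            h ^ 2 * h ^ 2 * h ^ 2                      ≈⟨ *-congʳ (*-cong (trans (^-congˡ q h²ᵠ≈h²) h²ᵠ≈h²) h²ᵠ≈h²) ⟨
            ((h ^ 2) ^ q) ^ q * (h ^ 2) ^ q * h ^ 2    ≈⟨ μ-expand (h ^ 2) ⟨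
            (h ^ 2) ^ (q ℕ.* q ℕ.+ q ℕ.+ 1)            ≈⟨ μh² ⟩
            1#                                         ≈⟨ solve 0 (:1 := :1 :^ 2) refl ⟩
            1# ^ 2                                     ∎)

        μ⇒period : ∀ {x} → μ x → ((x ^ q) ^ q) ^ q ≈ x
        μ⇒period {x} μx = *-cancelˡ (*≈1⇒nonzero zyx≈1) (begin
          z * y * z ^ q          ≈⟨ solve 3 (λ a b c → a :* b :* c := c :* a :* b) refl z y (z ^ q) ⟩
          z ^ q * z * y          ≈⟨ trans (^-distrib-* (z * y) x q) (*-congʳ (^-distrib-* z y q)) ⟨
          (z * y * x) ^ q        ≈⟨ ^-congˡ q zyx≈1 ⟩
          1# ^ q                 ≈⟨ 1^n≈1 q ⟩
          1#                     ≈⟨ zyx≈1 ⟨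
          z * y * x              ∎)
          where
          y = x ^ q
          z = y ^ q
          zyx≈1 : z * y * x ≈ 1#
          zyx≈1 = trans (sym (μ-expand x)) μx

        period⇒x^q^[3k+r] : ∀ {x} → ((x ^ q) ^ q) ^ q ≈ x → ∀ k r → x ^ (q ℕ.^ (k ℕ.* 3 ℕ.+ r)) ≈ x ^ (q ℕ.^ r)
        period⇒x^q^[3k+r] {x} period zero    r = refl
        period⇒x^q^[3k+r] {x} period (suc k) r = begin
          x ^ (q ℕ.* (q ℕ.* (q ℕ.* n)))  ≈⟨ ^-assocʳ x q _ ⟨
          (x ^ q) ^ (q ℕ.* (q ℕ.* n))    ≈⟨ ^-assocʳ (x ^ q) q _ ⟨
          ((x ^ q) ^ q) ^ (q ℕ.* n)      ≈⟨ ^-assocʳ ((x ^ q) ^ q) q n ⟨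
          (((x ^ q) ^ q) ^ q) ^ n        ≈⟨ ^-congˡ n period ⟩
          x ^ n                          ≈⟨ period⇒x^q^[3k+r] period k r ⟩
          x ^ (q ℕ.^ r)                  ∎
          where n = q ℕ.^ (k ℕ.* 3 ℕ.+ r)

        period⇒x^q^l : ∀ {x} → ((x ^ q) ^ q) ^ q ≈ x → x ^ (q ℕ.^ l) ≈ x ^ q ⊎ x ^ (q ℕ.^ l) ≈ (x ^ q) ^ q
        period⇒x^q^l {x} period = Data.Sum.map l%3≡1⇒ l%3≡2⇒ (coprime⇒unit₃ l⊥3)
          where
          x^q^l : x ^ (q ℕ.^ l) ≈ x ^ (q ℕ.^ (l % 3))
          x^q^l = trans (^-congʳ x (≡.cong (q ℕ.^_) (≡.trans (m≡m%n+[m/n]*n l 3) (ℕ.+-comm (l % 3) _))))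
                        (period⇒x^q^[3k+r] period (l / 3) (l % 3))

          l%3≡1⇒ : l % 3 ≡ 1 → x ^ (q ℕ.^ l) ≈ x ^ q
          l%3≡1⇒ l%3≡1 = begin
            x ^ (q ℕ.^ l)        ≈⟨ x^q^l ⟩
            x ^ (q ℕ.^ (l % 3))  ≈⟨ ^-congʳ x (≡.cong (q ℕ.^_) l%3≡1) ⟩
            x ^ (q ℕ.* 1)        ≈⟨ ^-congʳ x (ℕ.*-identityʳ q) ⟩
            x ^ q                ∎

          l%3≡2⇒ : l % 3 ≡ 2 → x ^ (q ℕ.^ l) ≈ (x ^ q) ^ q
          l%3≡2⇒ l%3≡2 = begin
            x ^ (q ℕ.^ l)          ≈⟨ x^q^l ⟩
            x ^ (q ℕ.^ (l % 3))    ≈⟨ ^-congʳ x (≡.cong (q ℕ.^_) l%3≡2) ⟩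
            x ^ (q ℕ.* (q ℕ.* 1))  ≈⟨ ^-assocʳ x q (q ℕ.* 1) ⟨
            (x ^ q) ^ (q ℕ.* 1)    ≈⟨ ^-congʳ (x ^ q) (ℕ.*-identityʳ q) ⟩
            (x ^ q) ^ q            ∎

        -- With y = x^q and z = y^q, G x = 0 reads x y² + h x + e = 0 or x z² + h x + e = 0
        -- (as l ≡ ±1 mod 3), and a Frobenius conjugate of it supplies the second hypothesis
        -- of cubic-from-orbit.
        root⇒cubic : ∀ {x} → Root x → cubic x ≈ 0#
        root⇒cubic {x} (μx , Gx≈0) = [ (λ x+h²≈0 → contradiction (μ-h² (x+y≈0⇒x≈y x+h²≈0)) h²∉μ) , (λ c≈0 → c≈0) ]′
                                       (*-integral ([ via-y , via-z ]′ (period⇒x^q^l period)))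
          where
          y = x ^ q
          z = y ^ q
          period = μ⇒period μx

          μ-h² : x ≈ h ^ 2 → μ (h ^ 2)
          μ-h² x≈h² = trans (^-congˡ (q ℕ.* q ℕ.+ q ℕ.+ 1) (sym x≈h²)) μx

          zyx≈1 : z * y * x ≈ 1#
          zyx≈1 = trans (sym (μ-expand x)) μx

          G-shape : ∀ {t} → x ^ (q ℕ.^ l) ≈ t → x * t ^ 2 + h * x + e ≈ 0#
          G-shape xᵠˡ≈t = trans (+-congʳ (+-congʳ (trans (*-congˡ (^-congˡ 2 (sym xᵠˡ≈t))) (sym (^-2n+1 x (q ℕ.^ l))))))
                                Gx≈0

          zᵠ≈x : ∀ {s} → s * (z ^ q) ^ 2 + h * s + e ≈ 0# → s * x ^ 2 + h * s + e ≈ 0#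
          zᵠ≈x = trans (+-congʳ (+-congʳ (*-congˡ (^-congˡ 2 (sym period)))))

          via-y : x ^ (q ℕ.^ l) ≈ y → (x + h ^ 2) * cubic x ≈ 0#
          via-y xᵠˡ≈y = cubic-from-orbit (trans (solve 3 (λ a b c → a :* b :* c := c :* b :* a) refl x y z) zyx≈1)
                                         (G-shape xᵠˡ≈y) (zᵠ≈x (frobenius-G (frobenius-G (G-shape xᵠˡ≈y))))

          via-z : x ^ (q ℕ.^ l) ≈ z → (x + h ^ 2) * cubic x ≈ 0#
          via-z xᵠˡ≈z = cubic-from-orbit (trans (solve 3 (λ a b c → a :* b :* c := b :* c :* a) refl x z y) zyx≈1)
                                         (G-shape xᵠˡ≈z) (zᵠ≈x (frobenius-G (G-shape xᵠˡ≈z)))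

        cubic⇒x[] : ∀ {x} → cubic x ≈ 0# → ∃[ σ ] σ ^ 3 ≈ 1# × x ≈ x[ σ ]
        cubic⇒x[] cubic≈0 = [ (λ x≈x₁ → 1# , 1^n≈1 3 , x≈x₁)
                            , [ (λ x≈xω → ω , ω³≈1 , x≈xω) , (λ x≈xω² → ω ^ 2 , μ₃-^ ω³≈1 2 , x≈xω²) ]′
                            ]′ (cubic-roots p cubic≈0)

        root⇒cond : ∀ {x} → Root x → Cond
        root⇒cond {x} root = at-index (cubic⇒x[] (root⇒cubic root))
          where
          at-index : ∃[ σ ] σ ^ 3 ≈ 1# × x ≈ x[ σ ] → Cond
          at-index (σ , σ³≈1 , x≈xσ) = Equivalence.from cond⇔ρˡ≈ω (G≈0⇒ρˡ≈ω σ³≈1 (proj₂ (Root-cong x≈xσ root)))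

        cubic⇒root : Cond → ∀ {x} → cubic x ≈ 0# → Root x
        cubic⇒root cond cubic≈0 = at-index (cubic⇒x[] cubic≈0)
          where
          at-index : ∀ {x} → ∃[ σ ] σ ^ 3 ≈ 1# × x ≈ x[ σ ] → Root x
          at-index (σ , σ³≈1 , x≈xσ) = Root-cong (sym x≈xσ) (ρˡ≈ω⇒root σ³≈1 (Equivalence.to cond⇔ρˡ≈ω cond))

        cond⇒three : Cond → Three
        cond⇒three cond = x[ 1# ] , x[ ω ] , x[ ω ^ 2 ]
                        , is-root (1^n≈1 3) , is-root ω³≈1 , is-root (μ₃-^ ω³≈1 2)
                        , (λ x₁≈xω → ω≉1 (sym (root-injective p (1^n≈1 3) ω³≈1 x₁≈xω)))
                        , (λ x₁≈xω² → ω²≉1 (sym (root-injective p (1^n≈1 3) (μ₃-^ ω³≈1 2) x₁≈xω²)))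
                        , (λ xω≈xω² → ω≉ω² (root-injective p ω³≈1 (μ₃-^ ω³≈1 2) xω≈xω²))
                        , (λ x root → cubic-roots p (root⇒cubic root))
          where
          is-root : ∀ {σ} → σ ^ 3 ≈ 1# → Root x[ σ ]
          is-root σ³≈1 = ρˡ≈ω⇒root σ³≈1 (Equivalence.to cond⇔ρˡ≈ω cond)

        no-roots-or-three : (∀ x → ¬ Root x) ⊎ Three
        no-roots-or-three = decide (((e + ω) ^ ((q ℕ.* q ∸ 1) / 3) * ω ^ l) ≟ 1#)
          where
          decide : Dec Cond → (∀ x → ¬ Root x) ⊎ Three
          decide (yes cond)  = inj₂ (cond⇒three cond)
          decide (no  ¬cond) = inj₁ (λ x root → ¬cond (root⇒cond root))

        three⇔cond : Three ⇔ Cond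
        three⇔cond = mk⇔ (λ (_ , _ , _ , root₁ , _) → root⇒cond root₁) cond⇒three

        root⇔cubic : Cond → ∀ x → Root x ⇔ cubic x ≈ 0#
        root⇔cubic cond x = mk⇔ root⇒cubic (cubic⇒root cond)

      module Parametrisation (l : ℕ) (l⊥3 : Coprime l 3) (e≉1 : ¬ e ≈ 1#)
                             (se sh b c : Carrier) (se²≈e : se * se ≈ e) (sh²≈h : sh * sh ≈ h)
                             (bse≈1 : b * se ≈ 1#) (c[b+ω²]≈b+ω : c * (b + ω ^ 2) ≈ b + ω) where

        open PairsFromωc se sh b c se²≈e sh²≈h bse≈1 c[b+ω²]≈b+ω

        v₀ w₀ : Carrier
        v₀ = proj₁ cube-root-of-ωc
        w₀ = proj₁ (proj₂ cube-root-of-ωc)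

        v₀³≈ωc : v₀ ^ 3 ≈ ω * c
        v₀³≈ωc = proj₁ (proj₂ (proj₂ cube-root-of-ωc))

        v₀w₀≈1 : v₀ * w₀ ≈ 1#
        v₀w₀≈1 = proj₂ (proj₂ (proj₂ cube-root-of-ωc))

        pair : IsCardanoPair (sh * v₀) (sh * w₀)
        pair = cube-roots-of-ωc v₀³≈ωc v₀w₀≈1

        open RootsOfG l l⊥3 e≉1 pair (proj₂ (frobenius-rotation pair)) public

        root⇔cube-roots-of-ωc : Cond → ∀ x →
          Root x ⇔ (∃[ v ] ∃[ w ] (v ^ 3 ≈ ω * c × v * w ≈ 1# × x ≈ h ^ 2 + e * sh * (v + w)))
        root⇔cube-roots-of-ωc cond x = mk⇔ to from
          where
          to : Root x → ∃[ v ] ∃[ w ] (v ^ 3 ≈ ω * c × v * w ≈ 1# × x ≈ h ^ 2 + e * sh * (v + w))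
          to root = rotate-base (cubic⇒x[] (root⇒cubic root))
            where
            rotate-base : ∃[ σ ] σ ^ 3 ≈ 1# × x ≈ x[ σ ] →
                          ∃[ v ] ∃[ w ] (v ^ 3 ≈ ω * c × v * w ≈ 1# × x ≈ h ^ 2 + e * sh * (v + w))
            rotate-base (σ , σ³≈1 , x≈xσ) = σ * v₀ , σ ^ 2 * w₀ , [σv₀]³≈ωc , [σv₀][σ²w₀]≈1 , x≈
              where
              [σv₀]³≈ωc : (σ * v₀) ^ 3 ≈ ω * c
              [σv₀]³≈ωc = trans (^-distrib-* σ v₀ 3) (trans (*-cong σ³≈1 v₀³≈ωc) (*-identityˡ _))

              [σv₀][σ²w₀]≈1 : σ * v₀ * (σ ^ 2 * w₀) ≈ 1#
              [σv₀][σ²w₀]≈1 = begin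
                σ * v₀ * (σ ^ 2 * w₀)  ≈⟨ solve 3 (λ σ v w → σ :* v :* (σ :^ 2 :* w) := σ :^ 3 :* (v :* w)) refl σ v₀ w₀ ⟩
                σ ^ 3 * (v₀ * w₀)      ≈⟨ *-cong σ³≈1 v₀w₀≈1 ⟩
                1# * 1#                ≈⟨ *-identityˡ 1# ⟩
                1#                     ∎

              x≈ : x ≈ h ^ 2 + e * sh * (σ * v₀ + σ ^ 2 * w₀)
              x≈ = trans x≈xσ (+-congˡ (solve 5 (λ e s σ v w →
                     e :* (σ :* (s :* v) :+ σ :^ 2 :* (s :* w)) := e :* s :* (σ :* v :+ σ :^ 2 :* w)) refl e sh σ v₀ w₀))

          from : ∃[ v ] ∃[ w ] (v ^ 3 ≈ ω * c × v * w ≈ 1# × x ≈ h ^ 2 + e * sh * (v + w)) → Root x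
          from (v , w , v³≈ωc , vw≈1 , x≈) = cubic⇒root cond (trans (cubic-cong x≈root) (root-of-cubic (cube-roots-of-ωc v³≈ωc vw≈1)))
            where
            x≈root : x ≈ root 1# (sh * v) (sh * w)
            x≈root = trans x≈ (+-congˡ (solve 4 (λ e s v w →
                       e :* s :* (v :+ w) := e :* (:1 :* (s :* v) :+ :1 :^ 2 :* (s :* w))) refl e sh v w))

proposition7p2 : ∀ {a r} (K : AlgClosureF2 a r) →
  let open AlgClosureF2 K
      open CommutativeRing cring
      _^_ = pow cring
  in (l m : ℕ) → l ≥ 1 → Coprime l 3 → m ≥ 1 →
  let q = 2 ℕ.^ m in
  -- ω ∈ 𝔽₄ ∖ 𝔽₂
  (ω : Carrier) → ω ^ 4 ≈ ω → ¬ (ω ≈ 0#) → ¬ (ω ≈ 1#) →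
  -- h, e ∈ 𝔽_q ∖ 𝔽₂ with h³ = e² + e + 1
  (h e : Carrier) → h ^ q ≈ h → ¬ (h ≈ 0#) → ¬ (h ≈ 1#) →
  e ^ q ≈ e → ¬ (e ≈ 0#) → ¬ (e ≈ 1#) →
  h ^ 3 ≈ e ^ 2 + e + 1# →
  -- se = √e ∈ 𝔽_q, sh = √h ∈ 𝔽_q
  (se : Carrier) → se ^ q ≈ se → se * se ≈ e →
  (sh : Carrier) → sh ^ q ≈ sh → sh * sh ≈ h →
  -- b = 1/√e
  (b : Carrier) → b * se ≈ 1# →
  -- c = (b + ω)/(b + ω²)
  (c : Carrier) → c * (b + ω ^ 2) ≈ b + ω →
  let G : Carrier → Carrier
      G x = x ^ (2 ℕ.* (q ℕ.^ l) ℕ.+ 1) + h * x + e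
      μ : Carrier → Set r
      μ x = x ^ (q ℕ.* q ℕ.+ q ℕ.+ 1) ≈ 1#
      Root : Carrier → Set r
      Root x = μ x × G x ≈ 0#
      cubic : Carrier → Carrier
      cubic x = x ^ 3 + (h ^ 2) * x ^ 2 + (e + 1#) * h * x + 1#
      Three : Set (a Level.⊔ r)
      Three = ∃[ x₁ ] ∃[ x₂ ] ∃[ x₃ ]
                (Root x₁ × Root x₂ × Root x₃ ×
                 ¬ (x₁ ≈ x₂) × ¬ (x₁ ≈ x₃) × ¬ (x₂ ≈ x₃) ×
                 (∀ x → Root x → (x ≈ x₁) ⊎ (x ≈ x₂) ⊎ (x ≈ x₃)))
      -- (e + ω)^((q² - 1)/3) = ω^(-l), i.e. (e + ω)^((q² - 1)/3) · ω^l = 1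
      Cond : Set r
      Cond = ((e + ω) ^ ((q ℕ.* q ∸ 1) ℕ./ 3)) * ω ^ l ≈ 1#
  in ((∀ x → ¬ Root x) ⊎ Three)
     × (Three ⇔ Cond)
     × (Cond → ∀ x →
          (Root x ⇔ (cubic x ≈ 0#))
          × (Root x ⇔ (∃[ v ] ∃[ w ] (v ^ 3 ≈ ω * c × v * w ≈ 1#
                                       × x ≈ h ^ 2 + e * sh * (v + w)))))
proposition7p2 K l m _ l⊥3 _ ω ω⁴≈ω ω≢0 ω≢1 h e hᵠ≈h h≢0 _ eᵠ≈e e≢0 e≢1 h³≈e²+e+1
               se _ se²≈e sh _ sh²≈h b bse≈1 c c[b+ω²]≈b+ω =
  no-roots-or-three , three⇔cond , λ cond x → root⇔cubic cond x , root⇔cube-roots-of-ωc cond x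
  where
  open FieldTheory.CardanoPairs K ω (FieldTheory.primitive-cube-root K ω⁴≈ω ω≢0 ω≢1) e h h³≈e²+e+1 e≢0 h≢0
  open Frobenius m hᵠ≈h eᵠ≈e
  open Parametrisation l l⊥3 e≢1 se sh b c se²≈e sh²≈h bse≈1 c[b+ω²]≈b+ω
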